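{- Let $N$ be an odd integer and $q$ a prime such that every prime divisor $p$ of $N$ satisfies $p\equiv 1\pmod q$. Write $N-1=q^s t$ with $\gcd(q,t)=1$. Then the number $B_{qpp}(N)$ of bases $b\in\mathbb{U}_N$ such that $N$ is a $q$-probable prime base $b$ is \[ B_{qpp}(N)=\left(1+(q-1)^{\omega(N)}\frac{q^{\nu(q,N)\,\omega(N)}-1}{q^{\omega(N)}-1}\right)\prod_{p\mid N}\gcd(p-1,\ t), \] where the product runs over the distinct prime divisors $p$ of $N$.
   Context: $\mathbb{U}_N$ is the set of positive integers less than $N$ and coprime to $N$; $|b|_p$ is the multiplicative order of $b$ modulo $p$; $\nu_q(m)$ is the exponent of $q$ in the prime factorization of $m$; $\omega(N)$ is the number of distinct prime divisors of $N$. If $p_1,\dots,p_{\omega(N)}$ are the distinct prime divisors of $N$, then $\nu(q,N)=\nu_q\left(\gcd(p_1-1,\ldots,p_{\omega(N)}-1)\right)$. Definition: let $N,b$ be integers with $\gcd(b,N)=1$ and $b^{N-1}\equiv 1\pmod N$, and let $q$ be a prime dividing $p-1$ for every prime $p\mid N$. Then $N$ is a $q$-probable prime base $b$ if there is a nonnegative integer $k$ such that $\nu_q(|b|_p)=k$ for every prime divisor $p$ of $N$. -}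

module Defs where

open import Data.Nat using (ℕ; suc; _+_; _*_; _∸_; _^_; _≤_; _<_)
open import Data.Nat.Divisibility using (_∣_)
open import Data.Nat.Coprimality using (Coprime)
open import Data.Nat.Primality using (Prime)
open import Data.Nat.GCD using (gcd)
open import Data.Integer as ℤ using (ℤ; +_)
import Data.Integer.Divisibility as ℤD
open import Data.List using (List; foldr; map)
open import Data.List.Membership.Propositional using (_∈_)
open import Data.List.Relation.Unary.Unique.Propositional using (Unique)
open import Data.Product using (Σ; ∃; _×_)
open import Relation.Nullary using (¬_)
open import Relation.Binary.PropositionalEquality using (_≡_)
open import Function.Bundles using (_⇔_)

infix 4 _≡_[mod_]
_≡_[mod_] : ℕ → ℕ → ℕ → Set
a ≡ b [mod n ] = (+ n) ℤD.∣ ((+ a) ℤ.- (+ b))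

Odd : ℕ → Set
Odd N = ∃ λ k → N ≡ suc (2 * k)

Val : ℕ → ℕ → ℕ → Set
Val q m e = (q ^ e ∣ m) × ¬ (q ^ suc e ∣ m)

Order : ℕ → ℕ → ℕ → Set
Order b p k = (0 < k) × (b ^ k ≡ 1 [mod p ]) ×
              (∀ j → 0 < j → j < k → ¬ (b ^ j ≡ 1 [mod p ]))

InU : ℕ → ℕ → Set
InU N b = (0 < b) × (b < N) × Coprime b N

QProbablePrime : ℕ → ℕ → ℕ → Set
QProbablePrime q N b =
  Coprime b N ×
  (b ^ (N ∸ 1) ≡ 1 [mod N ]) ×
  Prime q ×
  (∀ p → Prime p → p ∣ N → q ∣ (p ∸ 1)) ×
  (∃ λ k → ∀ p → Prime p → p ∣ N → ∀ o → Order b p o → Val q o k)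

PrimeDivisorList : ℕ → List ℕ → Set
PrimeDivisorList N ps = Unique ps × (∀ p → p ∈ ps ⇔ (Prime p × p ∣ N))

gcdList : List ℕ → ℕ
gcdList = foldr gcd 0

-- xs enumerates (without repetition) exactly the bases b ∈ 𝕌_N such that
-- N is a q-probable prime base b; so length xs = B_qpp(N)
QppBaseList : ℕ → ℕ → List ℕ → Set
QppBaseList q N xs = Unique xs × (∀ b → b ∈ xs ⇔ (InU N b × QProbablePrime q N b))

-- Write m = N - 1 = q ^ s t and call k the level of a base b with b ^ m ≡ 1 (mod N) when
-- ν_q (|b|_p) = k for every prime p ∣ N. No such p divides m, so the solutions of b ^ m ≡ 1 of a
-- given level lift uniquely from p to p ^ e (Hensel) and combine across primes by the Chinese
-- remainder theorem: their number is the product of the local counts. Modulo p, Fermat's little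
-- theorem and Lagrange's bound on the roots of a polynomial show that x ^ d ≡ 1 has exactly d
-- solutions for d ∣ p - 1. Hence the x with x ^ m ≡ 1 and ν_q (|x|_p) ≤ j number
-- gcd (q ^ j t, p - 1) = q ^ j gcd (p - 1, t) for j ≤ ν, those of level exactly k number
-- φ (q ^ k) gcd (p - 1, t), and no base has level above ν. Summing the products over the levels
-- 0 … ν is a geometric sum in q ^ ω(N).

module Submission where

open import Defs
open import Data.Empty using (⊥; ⊥-elim)
import Data.Integer as ℤ
import Data.Integer.Properties as ℤ
open import Data.List using (List; []; _∷_; _++_; length; map; filter; downFrom; replicate)
open import Data.List.Membership.Propositional using (_∈_)
open import Data.List.Membership.Propositional.Properties using (∈-∃++; ∈-map⁺; ∈-map⁻; ∈-filter⁺; ∈-filter⁻; ∈-downFrom⁺; ∈-downFrom⁻)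
open import Data.List.Properties using (length-++; length-map; length-downFrom; length-replicate; ++-identityʳ; filter-accept; filter-reject; filter-all)
open import Data.List.Relation.Binary.Permutation.Propositional using (_↭_; ↭-refl; ↭-trans; prep)
open import Data.List.Relation.Binary.Permutation.Propositional.Properties using (shift; ↭-length; ∈-resp-↭)
open import Data.List.Relation.Unary.All as All using (All; []; _∷_)
open import Data.List.Relation.Unary.All.Properties using (All¬⇒¬Any)
open import Data.List.Relation.Unary.AllPairs using ([]; _∷_)
open import Data.List.Relation.Unary.Any using (here; there)
open import Data.List.Relation.Unary.Unique.Propositional using (Unique)
import Data.List.Relation.Unary.Unique.Propositional.Properties as Unique
open import Data.Nat using (ℕ; zero; suc; _+_; _*_; _∸_; _^_; _≤_; _<_; z≤n; s≤s; z<s; _≟_; ∣_-_∣; NonZero; >-nonZero; >-nonZero⁻¹; nonTrivial⇒n>1)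
open import Data.Nat.Coprimality using (Coprime; coprime-divisor; coprime-Bézout)
import Data.Nat.Coprimality as Coprime
open import Data.Nat.DivMod
open import Data.Nat.Divisibility
open import Data.Nat.GCD
open import Data.Nat.ListAction using (product)
open import Data.Nat.ListAction.Properties using (product-↭; ∈⇒∣product)
open import Data.Nat.Primality using (Prime; prime?; euclidsLemma; prime⇒irreducible; prime⇒nonZero; prime⇒nonTrivial; ¬prime[1]; productOfPrimes≢0)
open import Data.Nat.Primality.Factorisation using (factorise)
open import Data.Nat.Properties
open import Algebra.Properties.CommutativeSemigroup *-commutativeSemigroup using (x∙yz≈y∙xz; xy∙z≈xz∙y) renaming (interchange to *-interchange)
open import Data.Nat.Solver using (module +-*-Solver)
open import Data.Product using (∃; _×_; _,_; proj₁; proj₂)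
open import Data.Sum using (_⊎_; inj₁; inj₂)
open import Function.Bundles using (mk⇔; Equivalence)
open import Level using (0ℓ)
open import Relation.Binary.Bundles using (Setoid)
open import Relation.Binary.Definitions using (tri<; tri≈; tri>)
import Relation.Binary.Reasoning.Setoid as SetoidReasoning
open import Relation.Binary.PropositionalEquality
open import Relation.Nullary using (¬_; Dec; yes; no)
open import Relation.Nullary.Decidable using (_×-dec_; _⊎-dec_; ¬?; map′)
open import Relation.Unary using (Decidable)
open +-*-Solver

-- Counting below a bound

∈-++-skip : ∀ {x y} (as bs : List ℕ) → y ∈ as ++ x ∷ bs → y ≢ x → y ∈ as ++ bs
∈-++-skip []       bs (here y≡x)  y≢x = ⊥-elim (y≢x y≡x)
∈-++-skip []       bs (there y∈)  _   = y∈
∈-++-skip (a ∷ as) bs (here y≡a)  _   = here y≡a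
∈-++-skip (a ∷ as) bs (there y∈)  y≢x = there (∈-++-skip as bs y∈ y≢x)

unique-⊆⇒↭++ : ∀ xs ys → Unique xs → (∀ {z} → z ∈ xs → z ∈ ys) → ∃ λ zs → ys ↭ xs ++ zs
unique-⊆⇒↭++ []       ys _             _   = ys , ↭-refl
unique-⊆⇒↭++ (x ∷ xs) ys (x∉xs ∷ !xs) xs⊆ys with ∈-∃++ (xs⊆ys (here refl))
... | as , bs , refl with unique-⊆⇒↭++ xs (as ++ bs) !xs
      (λ z∈xs → ∈-++-skip as bs (xs⊆ys (there z∈xs)) λ { refl → All¬⇒¬Any x∉xs z∈xs })
... | zs , ys↭ = zs , ↭-trans (shift x as bs) (prep x ys↭)

unique-⊆⇒length-≤ : ∀ xs ys → Unique xs → (∀ {z} → z ∈ xs → z ∈ ys) → length xs ≤ length ys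
unique-⊆⇒length-≤ xs ys !xs xs⊆ys with unique-⊆⇒↭++ xs ys !xs xs⊆ys
... | zs , ys↭ rewrite ↭-length ys↭ | length-++ xs {zs} = m≤m+n (length xs) (length zs)

unique-⊆⇒length-≡ : ∀ xs ys → Unique xs → Unique ys →
  (∀ {z} → z ∈ xs → z ∈ ys) → (∀ {z} → z ∈ ys → z ∈ xs) → length xs ≡ length ys
unique-⊆⇒length-≡ xs ys !xs !ys xs⊆ys ys⊆xs =
  ≤-antisym (unique-⊆⇒length-≤ xs ys !xs xs⊆ys) (unique-⊆⇒length-≤ ys xs !ys ys⊆xs)

unique-⊆-length-≥⇒↭ : ∀ xs ys → Unique xs → (∀ {z} → z ∈ xs → z ∈ ys) →
  length ys ≤ length xs → ys ↭ xs
unique-⊆-length-≥⇒↭ xs ys !xs xs⊆ys ys≤xs with unique-⊆⇒↭++ xs ys !xs xs⊆ys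
... | [] , ys↭ = subst (ys ↭_) (++-identityʳ xs) ys↭
... | z ∷ zs , ys↭ = ⊥-elim (<⇒≱ xs<ys ys≤xs)
  where
    xs<ys : length xs < length ys
    xs<ys rewrite ↭-length ys↭ | length-++ xs {z ∷ zs} = m<m+n (length xs) z<s

unique-map⁺ : (f : ℕ → ℕ) {xs : List ℕ} → Unique xs →
  (∀ {x y} → x ∈ xs → y ∈ xs → f x ≡ f y → x ≡ y) → Unique (map f xs)
unique-map⁺ f {[]}     []            _   = []
unique-map⁺ f {x ∷ xs} (x∉xs ∷ !xs) inj =
  all-map xs x∉xs (λ y∈ → y∈) ∷ unique-map⁺ f !xs (λ x∈ y∈ → inj (there x∈) (there y∈))
  where
    all-map : ∀ ys → All (x ≢_) ys → (∀ {y} → y ∈ ys → y ∈ xs) → All (f x ≢_) (map f ys)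
    all-map []       []             _     = []
    all-map (y ∷ ys) (x≢y ∷ x∉ys) ys⊆xs =
      (λ fx≡fy → x≢y (inj (here refl) (there (ys⊆xs (here refl))) fx≡fy))
      ∷ all-map ys x∉ys (λ y∈ → ys⊆xs (there y∈))

module _ {P : ℕ → Set} (P? : Decidable P) where

  count : ℕ → ℕ
  count n = length (filter P? (downFrom n))

  count-accept : ∀ n → P n → count (suc n) ≡ suc (count n)
  count-accept n Pn rewrite filter-accept P? {n} {downFrom n} Pn = refl

  count-reject : ∀ n → ¬ P n → count (suc n) ≡ count n
  count-reject n ¬Pn rewrite filter-reject P? {n} {downFrom n} ¬Pn = refl

  unique-filter-downFrom : ∀ n → Unique (filter P? (downFrom n))
  unique-filter-downFrom n = Unique.filter⁺ P? (Unique.downFrom⁺ n)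

  ∈-filter-downFrom⁺ : ∀ {n x} → x < n → P x → x ∈ filter P? (downFrom n)
  ∈-filter-downFrom⁺ x<n Px = ∈-filter⁺ P? (∈-downFrom⁺ x<n) Px

  ∈-filter-downFrom⁻ : ∀ {n x} → x ∈ filter P? (downFrom n) → x < n × P x
  ∈-filter-downFrom⁻ x∈ with ∈-filter⁻ P? x∈
  ... | x∈downFrom , Px = ∈-downFrom⁻ x∈downFrom , Px

  count-none : ∀ n → (∀ {x} → x < n → ¬ P x) → count n ≡ 0
  count-none zero    _  = refl
  count-none (suc n) ¬P = trans (count-reject n (¬P ≤-refl))
    (count-none n (λ x<n → ¬P (m<n⇒m<1+n x<n)))

  count-all : ∀ n → (∀ {x} → x < n → P x) → count n ≡ n
  count-all zero    _   = refl
  count-all (suc n) all = trans (count-accept n (all ≤-refl))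
    (cong suc (count-all n (λ x<n → all (m<n⇒m<1+n x<n))))

  count-≥-pred : ∀ n → (∀ {x} → 0 < x → x < n → P x) → n ∸ 1 ≤ count n
  count-≥-pred zero          _   = z≤n
  count-≥-pred (suc zero)    _   = z≤n
  count-≥-pred (suc (suc n)) all = ≤-trans
    (s≤s (count-≥-pred (suc n) (λ 0<x x<n → all 0<x (m<n⇒m<1+n x<n))))
    (≤-reflexive (sym (count-accept (suc n) (all z<s ≤-refl))))

count-bijection : {P Q : ℕ → Set} (P? : Decidable P) (Q? : Decidable Q) (A B : ℕ) (h : ℕ → ℕ) →
  (∀ {x} → x < A → P x → h x < B × Q (h x)) →
  (∀ {x y} → x < A → y < A → P x → P y → h x ≡ h y → x ≡ y) →
  (∀ {y} → y < B → Q y → ∃ λ x → x < A × P x × h x ≡ y) →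
  count P? A ≡ count Q? B
count-bijection P? Q? A B h into inj onto = begin
  length Ps              ≡⟨ length-map h Ps ⟨
  length (map h Ps)      ≡⟨ unique-⊆⇒length-≡ (map h Ps) Qs !hPs (unique-filter-downFrom Q? B) hPs⊆Qs Qs⊆hPs ⟩
  length Qs              ∎
  where
    open ≡-Reasoning
    Ps = filter P? (downFrom A)
    Qs = filter Q? (downFrom B)
    !hPs : Unique (map h Ps)
    !hPs = unique-map⁺ h (unique-filter-downFrom P? A) λ x∈ y∈ →
      let x<A , Px = ∈-filter-downFrom⁻ P? x∈ ; y<A , Py = ∈-filter-downFrom⁻ P? y∈
      in inj x<A y<A Px Py
    hPs⊆Qs : ∀ {z} → z ∈ map h Ps → z ∈ Qs
    hPs⊆Qs z∈ with ∈-map⁻ h z∈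
    ... | x , x∈ , refl with ∈-filter-downFrom⁻ P? {A} x∈
    ... | x<A , Px = let hx<B , Qhx = into x<A Px in ∈-filter-downFrom⁺ Q? hx<B Qhx
    Qs⊆hPs : ∀ {z} → z ∈ Qs → z ∈ map h Ps
    Qs⊆hPs z∈ with ∈-filter-downFrom⁻ Q? z∈
    ... | z<B , Qz with onto z<B Qz
    ... | x , x<A , Px , refl = ∈-map⁺ h (∈-filter-downFrom⁺ P? x<A Px)

count-cong : {P Q : ℕ → Set} (P? : Decidable P) (Q? : Decidable Q) (n : ℕ) →
  (∀ {x} → x < n → P x → Q x) → (∀ {x} → x < n → Q x → P x) → count P? n ≡ count Q? n
count-cong P? Q? n P⇒Q Q⇒P = count-bijection P? Q? n n (λ x → x)
  (λ x<n Px → x<n , P⇒Q x<n Px) (λ _ _ _ _ x≡y → x≡y) (λ {y} y<n Qy → y , y<n , Q⇒P y<n Qy , refl)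

module _ {P Q : ℕ → Set} (P? : Decidable P) (Q? : Decidable Q) where

  private
    P∧Q? : Decidable (λ x → P x × Q x)
    P∧Q? x = P? x ×-dec Q? x
    P∧¬Q? : Decidable (λ x → P x × ¬ Q x)
    P∧¬Q? x = P? x ×-dec ¬? (Q? x)

  count-split : ∀ n → count P? n ≡ count P∧Q? n + count P∧¬Q? n
  count-split zero = refl
  count-split (suc n) = step (P? n) (Q? n)
    where
      step : Dec (P n) → Dec (Q n) → count P? (suc n) ≡ count P∧Q? (suc n) + count P∧¬Q? (suc n)
      step (yes Pn) (yes Qn)
        rewrite count-accept P? n Pn | count-accept P∧Q? n (Pn , Qn) | count-reject P∧¬Q? n (λ (_ , ¬Qn) → ¬Qn Qn)
        = cong suc (count-split n)
      step (yes Pn) (no ¬Qn)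
        rewrite count-accept P? n Pn | count-reject P∧Q? n (λ (_ , Qn) → ¬Qn Qn) | count-accept P∧¬Q? n (Pn , ¬Qn)
        = trans (cong suc (count-split n)) (sym (+-suc _ _))
      step (no ¬Pn) _
        rewrite count-reject P? n ¬Pn | count-reject P∧Q? n (λ (Pn , _) → ¬Pn Pn) | count-reject P∧¬Q? n (λ (Pn , _) → ¬Pn Pn)
        = count-split n

module _ {P Q : ℕ → Set} (P? : Decidable P) (Q? : Decidable Q) where

  count-⊎ : ∀ n → count (λ x → P? x ⊎-dec Q? x) n ≡ count P? n + count (λ x → Q? x ×-dec ¬? (P? x)) n
  count-⊎ n = begin
    count P∨Q? n                                                          ≡⟨ count-split P∨Q? P? n ⟩
    count (λ x → P∨Q? x ×-dec P? x) n + count (λ x → P∨Q? x ×-dec ¬? (P? x)) n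
      ≡⟨ cong₂ _+_ (count-cong _ P? n (λ _ → proj₂) (λ _ Px → inj₁ Px , Px))
                   (count-cong _ (λ x → Q? x ×-dec ¬? (P? x)) n
                      (λ { _ (inj₁ Px , ¬Px) → ⊥-elim (¬Px Px) ; _ (inj₂ Qx , ¬Px) → Qx , ¬Px })
                      (λ _ (Qx , ¬Px) → inj₂ Qx , ¬Px)) ⟩
    count P? n + count (λ x → Q? x ×-dec ¬? (P? x)) n                    ∎
    where
      open ≡-Reasoning
      P∨Q? : Decidable (λ x → P x ⊎ Q x)
      P∨Q? x = P? x ⊎-dec Q? x

  count-⊎-≤ : ∀ n → count (λ x → P? x ⊎-dec Q? x) n ≤ count P? n + count Q? n
  count-⊎-≤ n = begin
    count (λ x → P? x ⊎-dec Q? x) n                  ≡⟨ count-⊎ n ⟩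
    count P? n + count (λ x → Q? x ×-dec ¬? (P? x)) n ≤⟨ +-monoʳ-≤ (count P? n) (m≤n+m _ _) ⟩
    count P? n + (count (λ x → Q? x ×-dec P? x) n + count (λ x → Q? x ×-dec ¬? (P? x)) n)
                                                      ≡⟨ cong (count P? n +_) (count-split Q? P? n) ⟨
    count P? n + count Q? n                           ∎
    where open ≤-Reasoning

  count-⊎-disjoint : ∀ n → (∀ {x} → P x → Q x → ⊥) →
    count (λ x → P? x ⊎-dec Q? x) n ≡ count P? n + count Q? n
  count-⊎-disjoint n disjoint = trans (count-⊎ n) (cong (count P? n +_)
    (count-cong _ Q? n (λ _ → proj₁) (λ _ Qx → Qx , λ Px → disjoint Px Qx)))

count-+ : {R : ℕ → Set} (R? : Decidable R) (k n : ℕ) →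
  count R? (k + n) ≡ count (λ x → R? (x + n)) k + count R? n
count-+ R? zero n = refl
count-+ {R} R? (suc k) n = step (R? (k + n))
  where
    step : Dec (R (k + n)) → count R? (suc k + n) ≡ count (λ x → R? (x + n)) (suc k) + count R? n
    step (yes R[k+n])
      rewrite count-accept R? (k + n) R[k+n] | count-accept (λ x → R? (x + n)) k R[k+n]
      = cong suc (count-+ R? k n)
    step (no ¬R[k+n])
      rewrite count-reject R? (k + n) ¬R[k+n] | count-reject (λ x → R? (x + n)) k ¬R[k+n]
      = count-+ R? k n

m<n⇒[m+kn]%n≡m : ∀ {m n} k .{{_ : NonZero n}} → m < n → (m + k * n) % n ≡ m
m<n⇒[m+kn]%n≡m {m} {n} k m<n = trans ([m+kn]%n≡m%n m k n) (m<n⇒m%n≡m m<n)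

m<n⇒[m+kn]/n≡k : ∀ {m n} k .{{_ : NonZero n}} → m < n → (m + k * n) / n ≡ k
m<n⇒[m+kn]/n≡k {m} {n} k m<n = trans (+-distrib-/-∣ʳ m (n∣m*n k)) (cong₂ _+_ (m<n⇒m/n≡0 m<n) (m*n/n≡m k n))

-- Pairs (x , y) with x < A, y < B are encoded as x + y * A < B * A.
count-× : {P Q : ℕ → Set} (P? : Decidable P) (Q? : Decidable Q) (A B : ℕ) .{{_ : NonZero A}} →
  count (λ z → P? (z % A) ×-dec Q? (z / A)) (B * A) ≡ count Q? B * count P? A
count-× P? Q? A zero = refl
count-× {P} {Q} P? Q? A (suc B) = begin
  count R? (A + B * A)                                ≡⟨ count-+ R? A (B * A) ⟩
  count (λ x → R? (x + B * A)) A + count R? (B * A)    ≡⟨ cong (count (λ x → R? (x + B * A)) A +_) (count-× P? Q? A B) ⟩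
  count (λ x → R? (x + B * A)) A + count Q? B * count P? A ≡⟨ block (Q? B) ⟩
  count Q? (suc B) * count P? A                        ∎
  where
    open ≡-Reasoning
    R? = λ z → P? (z % A) ×-dec Q? (z / A)
    block : Dec (Q B) → count (λ x → R? (x + B * A)) A + count Q? B * count P? A ≡ count Q? (suc B) * count P? A
    block (yes QB) rewrite count-accept Q? B QB = cong (_+ count Q? B * count P? A) (count-cong _ P? A
      (λ x<A (P[x%A] , _) → subst P (m<n⇒[m+kn]%n≡m B x<A) P[x%A])
      (λ x<A Px → subst P (sym (m<n⇒[m+kn]%n≡m B x<A)) Px , subst Q (sym (m<n⇒[m+kn]/n≡k B x<A)) QB))
    block (no ¬QB) rewrite count-reject Q? B ¬QB = cong (_+ count Q? B * count P? A) (count-none _ A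
      λ x<A (_ , Q[x/A]) → ¬QB (subst Q (m<n⇒[m+kn]/n≡k B x<A) Q[x/A]))

injective⇒surjective : (n : ℕ) (h : ℕ → ℕ) → (∀ {x} → x < n → h x < n) →
  (∀ {x y} → x < n → y < n → h x ≡ h y → x ≡ y) → ∀ {y} → y < n → ∃ λ x → x < n × h x ≡ y
injective⇒surjective n h into inj y<n with ∈-map⁻ h (∈-resp-↭ downFrom↭image (∈-downFrom⁺ y<n))
  where
    image = map h (downFrom n)
    image⊆downFrom : ∀ {z} → z ∈ image → z ∈ downFrom n
    image⊆downFrom z∈ with ∈-map⁻ h z∈
    ... | x , x∈ , refl = ∈-downFrom⁺ (into (∈-downFrom⁻ x∈))
    downFrom↭image : downFrom n ↭ image
    downFrom↭image = unique-⊆-length-≥⇒↭ image (downFrom n)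
      (unique-map⁺ h (Unique.downFrom⁺ n) λ x∈ y∈ → inj (∈-downFrom⁻ x∈) (∈-downFrom⁻ y∈))
      image⊆downFrom
      (≤-reflexive (trans (length-downFrom n) (sym (trans (length-map h (downFrom n)) (length-downFrom n)))))
... | x , x∈ , y≡hx = x , ∈-downFrom⁻ x∈ , sym y≡hx

-- Congruences

prime>1 : ∀ {p} → Prime p → 1 < p
prime>1 {p} pp = nonTrivial⇒n>1 p {{prime⇒nonTrivial pp}}

^-distribʳ-* : ∀ a b n → (a * b) ^ n ≡ a ^ n * b ^ n
^-distribʳ-* a b zero    = refl
^-distribʳ-* a b (suc n) = begin
  a * b * (a * b) ^ n      ≡⟨ cong (a * b *_) (^-distribʳ-* a b n) ⟩
  a * b * (a ^ n * b ^ n)  ≡⟨ *-interchange a b (a ^ n) (b ^ n) ⟩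
  a * a ^ n * (b * b ^ n)  ∎
  where open ≡-Reasoning

-- Congruence by remainders, easier to compute with than the integer form _≡_[mod_] of Defs.
infix 4 _≡_⟨mod_⟩

record _≡_⟨mod_⟩ (a b n : ℕ) .{{_ : NonZero n}} : Set where
  constructor mk≡mod
  field %-≡ : a % n ≡ b % n

open _≡_⟨mod_⟩ public

module _ {n : ℕ} .{{_ : NonZero n}} where

  ≡mod-refl : ∀ {a} → a ≡ a ⟨mod n ⟩
  ≡mod-refl = mk≡mod refl

  ≡mod-sym : ∀ {a b} → a ≡ b ⟨mod n ⟩ → b ≡ a ⟨mod n ⟩
  ≡mod-sym (mk≡mod e) = mk≡mod (sym e)

  ≡mod-trans : ∀ {a b c} → a ≡ b ⟨mod n ⟩ → b ≡ c ⟨mod n ⟩ → a ≡ c ⟨mod n ⟩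
  ≡mod-trans (mk≡mod e) (mk≡mod f) = mk≡mod (trans e f)

  ≡⇒≡mod : ∀ {a b} → a ≡ b → a ≡ b ⟨mod n ⟩
  ≡⇒≡mod refl = ≡mod-refl

≡mod-setoid : (n : ℕ) .{{_ : NonZero n}} → Setoid 0ℓ 0ℓ
≡mod-setoid n = record
  { _≈_           = λ a b → a ≡ b ⟨mod n ⟩
  ; isEquivalence = record { refl = ≡mod-refl ; sym = ≡mod-sym ; trans = ≡mod-trans }
  }

module ≡mod-Reasoning (n : ℕ) .{{_ : NonZero n}} = SetoidReasoning (≡mod-setoid n)

module _ {n : ℕ} .{{_ : NonZero n}} where

  +-cong-mod : ∀ {a a′ b b′} → a ≡ a′ ⟨mod n ⟩ → b ≡ b′ ⟨mod n ⟩ → a + b ≡ a′ + b′ ⟨mod n ⟩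
  +-cong-mod {a} {a′} {b} {b′} (mk≡mod e) (mk≡mod f) = mk≡mod (begin
    (a + b) % n            ≡⟨ %-distribˡ-+ a b n ⟩
    (a % n + b % n) % n    ≡⟨ cong₂ (λ x y → (x + y) % n) e f ⟩
    (a′ % n + b′ % n) % n  ≡⟨ %-distribˡ-+ a′ b′ n ⟨
    (a′ + b′) % n          ∎)
    where open ≡-Reasoning

  *-cong-mod : ∀ {a a′ b b′} → a ≡ a′ ⟨mod n ⟩ → b ≡ b′ ⟨mod n ⟩ → a * b ≡ a′ * b′ ⟨mod n ⟩
  *-cong-mod {a} {a′} {b} {b′} (mk≡mod e) (mk≡mod f) = mk≡mod (begin
    (a * b) % n              ≡⟨ %-distribˡ-* a b n ⟩
    (a % n * (b % n)) % n    ≡⟨ cong₂ (λ x y → (x * y) % n) e f ⟩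
    (a′ % n * (b′ % n)) % n  ≡⟨ %-distribˡ-* a′ b′ n ⟨
    (a′ * b′) % n            ∎)
    where open ≡-Reasoning

  ^-cong-mod : ∀ {a b} e → a ≡ b ⟨mod n ⟩ → a ^ e ≡ b ^ e ⟨mod n ⟩
  ^-cong-mod zero    _   = ≡mod-refl
  ^-cong-mod (suc e) a≡b = *-cong-mod a≡b (^-cong-mod e a≡b)

  1^-≡mod : ∀ {a} e → a ≡ 1 ⟨mod n ⟩ → a ^ e ≡ 1 ⟨mod n ⟩
  1^-≡mod e a≡1 = ≡mod-trans (^-cong-mod e a≡1) (≡⇒≡mod (^-zeroˡ e))

  %-≡mod : ∀ a → a % n ≡ a ⟨mod n ⟩
  %-≡mod a = mk≡mod (m%n%n≡m%n a n)

  ≡mod-<⇒≡ : ∀ {a b} → a < n → b < n → a ≡ b ⟨mod n ⟩ → a ≡ b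
  ≡mod-<⇒≡ a<n b<n (mk≡mod e) = trans (sym (m<n⇒m%n≡m a<n)) (trans e (m<n⇒m%n≡m b<n))

  ≡mod-<⇒%≡ : ∀ {a b} → b < n → a ≡ b ⟨mod n ⟩ → a % n ≡ b
  ≡mod-<⇒%≡ b<n (mk≡mod e) = trans e (m<n⇒m%n≡m b<n)

  infix 4 _≡mod?_
  _≡mod?_ : ∀ a b → Dec (a ≡ b ⟨mod n ⟩)
  a ≡mod? b with a % n ≟ b % n
  ... | yes e = yes (mk≡mod e)
  ... | no ¬e = no (λ a≡b → ¬e (%-≡ a≡b))

  private
    +-≡mod⇒∣ : ∀ b d → (b + d) % n ≡ b % n → n ∣ d
    +-≡mod⇒∣ b d e = divides ((b + d) / n ∸ b / n) (begin
      d                                  ≡⟨ m+n∸m≡n (b / n * n) d ⟨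
      b / n * n + d ∸ b / n * n          ≡⟨ cong (_∸ b / n * n) quotients ⟩
      (b + d) / n * n ∸ b / n * n        ≡⟨ *-distribʳ-∸ n ((b + d) / n) (b / n) ⟨
      ((b + d) / n ∸ b / n) * n          ∎)
      where
        open ≡-Reasoning
        quotients : b / n * n + d ≡ (b + d) / n * n
        quotients = +-cancelˡ-≡ (b % n) _ _ (begin
          b % n + (b / n * n + d)      ≡⟨ +-assoc (b % n) _ d ⟨
          b % n + b / n * n + d        ≡⟨ cong (_+ d) (m≡m%n+[m/n]*n b n) ⟨
          b + d                        ≡⟨ m≡m%n+[m/n]*n (b + d) n ⟩
          (b + d) % n + (b + d) / n * n ≡⟨ cong (_+ (b + d) / n * n) e ⟩
          b % n + (b + d) / n * n      ∎)

  ≡mod⇒∣∣-∣ : ∀ {a b} → a ≡ b ⟨mod n ⟩ → n ∣ ∣ a - b ∣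
  ≡mod⇒∣∣-∣ {a} {b} (mk≡mod e) with ≤-total b a
  ... | inj₁ b≤a = subst (n ∣_) (sym (m≤n⇒∣n-m∣≡n∸m b≤a))
          (+-≡mod⇒∣ b (a ∸ b) (trans (cong (_% n) (m+[n∸m]≡n b≤a)) e))
  ... | inj₂ a≤b = subst (n ∣_) (sym (m≤n⇒∣m-n∣≡n∸m a≤b))
          (+-≡mod⇒∣ a (b ∸ a) (trans (cong (_% n) (m+[n∸m]≡n a≤b)) (sym e)))

  ∣∣-∣⇒≡mod : ∀ {a b} → n ∣ ∣ a - b ∣ → a ≡ b ⟨mod n ⟩
  ∣∣-∣⇒≡mod {a} {b} n∣ with ≤-total b a
  ... | inj₁ b≤a = mk≡mod (trans (cong (_% n) (sym (m+[n∸m]≡n b≤a)))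
          (%-remove-+ʳ b (subst (n ∣_) (m≤n⇒∣n-m∣≡n∸m b≤a) n∣)))
  ... | inj₂ a≤b = mk≡mod (sym (trans (cong (_% n) (sym (m+[n∸m]≡n a≤b)))
          (%-remove-+ʳ a (subst (n ∣_) (m≤n⇒∣m-n∣≡n∸m a≤b) n∣))))

  ≡mod0⇒∣ : ∀ {a} → a ≡ 0 ⟨mod n ⟩ → n ∣ a
  ≡mod0⇒∣ {a} a≡0 = subst (n ∣_) (∣-∣-identityʳ a) (≡mod⇒∣∣-∣ a≡0)

  ∣⇒≡mod0 : ∀ {a} → n ∣ a → a ≡ 0 ⟨mod n ⟩
  ∣⇒≡mod0 {a} n∣a = ∣∣-∣⇒≡mod (subst (n ∣_) (sym (∣-∣-identityʳ a)) n∣a)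

  +-cancelʳ-≡mod : ∀ {a b c} → a + c ≡ b + c ⟨mod n ⟩ → a ≡ b ⟨mod n ⟩
  +-cancelʳ-≡mod {a} {b} {c} a+c≡b+c = ∣∣-∣⇒≡mod (subst (n ∣_)
    (trans (cong₂ ∣_-_∣ (+-comm a c) (+-comm b c)) (∣m+n-m+o∣≡∣n-o∣ c a b)) (≡mod⇒∣∣-∣ a+c≡b+c))

  -- A + m K ≡ B + m L is A ≡ B (mod m) without subtraction.
  ^-periodic : ∀ {c m} → c ^ m ≡ 1 ⟨mod n ⟩ → ∀ A B K L → A + m * K ≡ B + m * L → c ^ A ≡ c ^ B ⟨mod n ⟩
  ^-periodic {c} {m} c^m≡1 A B K L eq = begin
    c ^ A                ≡⟨ *-identityʳ (c ^ A) ⟨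
    c ^ A * 1            ≈⟨ *-cong-mod (≡mod-refl {a = c ^ A}) (period K) ⟨
    c ^ A * c ^ (m * K)  ≡⟨ ^-distribˡ-+-* c A (m * K) ⟨
    c ^ (A + m * K)      ≡⟨ cong (c ^_) eq ⟩
    c ^ (B + m * L)      ≡⟨ ^-distribˡ-+-* c B (m * L) ⟩
    c ^ B * c ^ (m * L)  ≈⟨ *-cong-mod (≡mod-refl {a = c ^ B}) (period L) ⟩
    c ^ B * 1            ≡⟨ *-identityʳ (c ^ B) ⟩
    c ^ B                ∎
    where
      open ≡mod-Reasoning n
      period : ∀ K → c ^ (m * K) ≡ 1 ⟨mod n ⟩
      period K = ≡mod-trans (≡⇒≡mod (sym (^-*-assoc c m K))) (1^-≡mod K c^m≡1)

≡mod-∣ : ∀ {d n} .{{_ : NonZero d}} .{{_ : NonZero n}} {a b} → d ∣ n → a ≡ b ⟨mod n ⟩ → a ≡ b ⟨mod d ⟩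
≡mod-∣ {d} {n} {a} {b} d∣n (mk≡mod e) =
  mk≡mod (trans (sym (m∣n⇒o%n%m≡o%m d n a d∣n)) (trans (cong (_% d) e) (m∣n⇒o%n%m≡o%m d n b d∣n)))

1≢0-mod : ∀ {p} .{{_ : NonZero p}} → 1 < p → ¬ (1 ≡ 0 ⟨mod p ⟩)
1≢0-mod 1<p 1≡0 = <⇒≱ 1<p (∣⇒≤ (≡mod0⇒∣ 1≡0))

∣ℤ-∣≡∣-∣ : ∀ a b → ℤ.∣ ℤ.+ a ℤ.- ℤ.+ b ∣ ≡ ∣ a - b ∣
∣ℤ-∣≡∣-∣ a b rewrite ℤ.m-n≡m⊖n a b with ≤-total a b
... | inj₁ a≤b = trans (ℤ.∣⊖∣-≤ a≤b) (sym (m≤n⇒∣m-n∣≡n∸m a≤b))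
... | inj₂ b≤a = trans (ℤ.∣m⊖n∣≡∣n⊖m∣ a b) (trans (ℤ.∣⊖∣-≤ b≤a) (sym (m≤n⇒∣n-m∣≡n∸m b≤a)))

[mod]⇒≡mod : ∀ {n} .{{_ : NonZero n}} {a b} → a ≡ b [mod n ] → a ≡ b ⟨mod n ⟩
[mod]⇒≡mod {n} {a} {b} n∣a-b = ∣∣-∣⇒≡mod (subst (n ∣_) (∣ℤ-∣≡∣-∣ a b) n∣a-b)

≡mod⇒[mod] : ∀ {n} .{{_ : NonZero n}} {a b} → a ≡ b ⟨mod n ⟩ → a ≡ b [mod n ]
≡mod⇒[mod] {n} {a} {b} a≡b = subst (n ∣_) (sym (∣ℤ-∣≡∣-∣ a b)) (≡mod⇒∣∣-∣ a≡b)

∣∧∣∣-1∣⇒∣1 : ∀ {d} a → d ∣ a → d ∣ ∣ a - 1 ∣ → d ∣ 1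
∣∧∣∣-1∣⇒∣1 zero        _     d∣1 = d∣1
∣∧∣∣-1∣⇒∣1 {d} (suc a) d∣1+a d∣a =
  ∣m+n∣m⇒∣n (subst (d ∣_) (+-comm 1 a) d∣1+a) (subst (d ∣_) (∣-∣-identityʳ a) d∣a)

^≡mod1⇒coprime : ∀ {n} .{{_ : NonZero n}} {b m} → 0 < m → b ^ m ≡ 1 ⟨mod n ⟩ → Coprime b n
^≡mod1⇒coprime {b = b} {m} 0<m b^m≡1 (d∣b , d∣n) = ∣1⇒≡1 (∣∧∣∣-1∣⇒∣1 (b ^ m)
  (subst (_ ∣_) (cong (b ^_) (m+[n∸m]≡n 0<m)) (∣m⇒∣m*n (b ^ (m ∸ 1)) d∣b)) (∣-trans d∣n (≡mod⇒∣∣-∣ b^m≡1)))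

coprime-∣⇒*-∣ : ∀ {A B d} → Coprime A B → A ∣ d → B ∣ d → A * B ∣ d
coprime-∣⇒*-∣ {A} {B} A⊥B (divides k refl) B∣kA =
  subst (A * B ∣_) (*-comm A k) (*-monoʳ-∣ A (coprime-divisor (Coprime.sym A⊥B) (subst (B ∣_) (*-comm k A) B∣kA)))

≡mod-coprime : ∀ {A B} .{{_ : NonZero A}} .{{_ : NonZero B}} .{{_ : NonZero (A * B)}} {a b} →
  Coprime A B → a ≡ b ⟨mod A ⟩ → a ≡ b ⟨mod B ⟩ → a ≡ b ⟨mod A * B ⟩
≡mod-coprime A⊥B a≡b₁ a≡b₂ = ∣∣-∣⇒≡mod (coprime-∣⇒*-∣ A⊥B (≡mod⇒∣∣-∣ a≡b₁) (≡mod⇒∣∣-∣ a≡b₂))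

product-≡mod1 : ∀ {n} .{{_ : NonZero n}} {xs} → All (λ x → x ≡ 1 ⟨mod n ⟩) xs → product xs ≡ 1 ⟨mod n ⟩
product-≡mod1 []             = ≡mod-refl
product-≡mod1 (x≡1 ∷ xs≡1) = *-cong-mod x≡1 (product-≡mod1 xs≡1)

module _ {p : ℕ} .{{_ : NonZero p}} (pp : Prime p) where

  *-cancelˡ-≡mod : ∀ {x y z} → x * y ≡ x * z ⟨mod p ⟩ → ¬ p ∣ x → y ≡ z ⟨mod p ⟩
  *-cancelˡ-≡mod {x} {y} {z} xy≡xz p∤x
    with euclidsLemma x ∣ y - z ∣ pp (subst (p ∣_) (sym (*-distribˡ-∣-∣ x y z)) (≡mod⇒∣∣-∣ xy≡xz))
  ... | inj₁ p∣x   = ⊥-elim (p∤x p∣x)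
  ... | inj₂ p∣y-z = ∣∣-∣⇒≡mod p∣y-z

  *-≡mod-≢⇒≡mod0 : ∀ {a b y} → a * y ≡ b * y ⟨mod p ⟩ → ¬ a ≡ b ⟨mod p ⟩ → y ≡ 0 ⟨mod p ⟩
  *-≡mod-≢⇒≡mod0 {a} {b} {y} ay≡by a≢b
    with euclidsLemma ∣ a - b ∣ y pp (subst (p ∣_) (sym (*-distribʳ-∣-∣ y a b)) (≡mod⇒∣∣-∣ ay≡by))
  ... | inj₁ p∣a-b = ⊥-elim (a≢b (∣∣-∣⇒≡mod p∣a-b))
  ... | inj₂ p∣y   = ∣⇒≡mod0 p∣y

  ^-≡mod1⇒∤ : ∀ {x e} → 0 < e → x ^ e ≡ 1 ⟨mod p ⟩ → ¬ p ∣ x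
  ^-≡mod1⇒∤ {x} {suc e} _ x^e≡1 p∣x =
    1≢0-mod (prime>1 pp) (≡mod-trans (≡mod-sym x^e≡1) (*-cong-mod (∣⇒≡mod0 p∣x) ≡mod-refl))

-- Fermat's little theorem and multiplicative orders

module _ {p : ℕ} .{{_ : NonZero p}} (pp : Prime p) where

  private
    units : List ℕ
    units = map suc (downFrom (p ∸ 1))

    ∈-units⁻ : ∀ {y} → y ∈ units → 0 < y × y < p
    ∈-units⁻ y∈ with ∈-map⁻ suc y∈
    ... | z , z∈ , refl = z<s , ≤-trans (s≤s (∈-downFrom⁻ z∈)) (≤-reflexive (m+[n∸m]≡n (<⇒≤ (prime>1 pp))))

    ∈-units⁺ : ∀ {y} → 0 < y → y < p → y ∈ units
    ∈-units⁺ {suc y} _ y<p = ∈-map⁺ suc (∈-downFrom⁺ (∸-monoˡ-≤ 1 y<p))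

    p∤unit : ∀ {y} → y ∈ units → ¬ p ∣ y
    p∤unit y∈ p∣y = let 0<y , y<p = ∈-units⁻ y∈ in <⇒≱ y<p (∣⇒≤ {{>-nonZero 0<y}} p∣y)

    p∤product : ∀ ys → (∀ {y} → y ∈ ys → y ∈ units) → ¬ p ∣ product ys
    p∤product []       _     p∣1 = <⇒≱ (prime>1 pp) (∣⇒≤ p∣1)
    p∤product (y ∷ ys) ys⊆us p∣ with euclidsLemma y (product ys) pp p∣
    ... | inj₁ p∣y  = p∤unit (ys⊆us (here refl)) p∣y
    ... | inj₂ p∣ys = p∤product ys (λ y∈ → ys⊆us (there y∈)) p∣ys

    product-map-*% : ∀ x ys → product (map (λ y → (x * y) % p) ys) ≡ x ^ length ys * product ys ⟨mod p ⟩
    product-map-*% x []       = ≡mod-refl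
    product-map-*% x (y ∷ ys) = ≡mod-trans (*-cong-mod (%-≡mod (x * y)) (product-map-*% x ys))
      (≡⇒≡mod (*-interchange x y (x ^ length ys) (product ys)))

  -- Multiplication by x permutes the nonzero residues, so their product picks up the factor x ^ (p - 1).
  fermat : ∀ x → ¬ p ∣ x → x ^ (p ∸ 1) ≡ 1 ⟨mod p ⟩
  fermat x p∤x = subst (λ k → x ^ k ≡ 1 ⟨mod p ⟩) length-units
    (≡mod-sym (*-cancelˡ-≡mod pp product-units≡ (p∤product units (λ y∈ → y∈))))
    where
      h : ℕ → ℕ
      h y = (x * y) % p
      length-units : length units ≡ p ∸ 1
      length-units = trans (length-map suc (downFrom (p ∸ 1))) (length-downFrom (p ∸ 1))
      h-units : ∀ {y} → y ∈ units → h y ∈ units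
      h-units {y} y∈ = ∈-units⁺ (n≢0⇒n>0 hy≢0) (m%n<n (x * y) p)
        where
          hy≢0 : h y ≢ 0
          hy≢0 hy≡0 with euclidsLemma x y pp (m%n≡0⇒n∣m (x * y) p hy≡0)
          ... | inj₁ p∣x = p∤x p∣x
          ... | inj₂ p∣y = p∤unit y∈ p∣y
      units↭image : units ↭ map h units
      units↭image = unique-⊆-length-≥⇒↭ (map h units) units
        (unique-map⁺ h (Unique.map⁺ suc-injective (Unique.downFrom⁺ (p ∸ 1))) λ y∈ z∈ hy≡hz →
          ≡mod-<⇒≡ (proj₂ (∈-units⁻ y∈)) (proj₂ (∈-units⁻ z∈)) (*-cancelˡ-≡mod pp (mk≡mod hy≡hz) p∤x))
        (λ z∈ → let y , y∈ , z≡hy = ∈-map⁻ h z∈ in subst (_∈ units) (sym z≡hy) (h-units y∈))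
        (≤-reflexive (sym (length-map h units)))
      product-units≡ : product units * 1 ≡ product units * x ^ length units ⟨mod p ⟩
      product-units≡ = begin
        product units * 1                 ≡⟨ *-identityʳ _ ⟩
        product units                     ≡⟨ product-↭ units↭image ⟩
        product (map h units)             ≈⟨ product-map-*% x units ⟩
        x ^ length units * product units  ≡⟨ *-comm (x ^ length units) (product units) ⟩
        product units * x ^ length units  ∎
        where open ≡mod-Reasoning p

least-from : {P : ℕ → Set} → Decidable P → ∀ i f → (∀ j → j < i → ¬ P j) → P (i + f) →
  ∃ λ k → P k × (∀ j → j < k → ¬ P j)
least-from {P} P? i zero    below Pi+f = i , subst P (+-identityʳ i) Pi+f , below
least-from {P} P? i (suc f) below Pi+f with P? i
... | yes Pi = i , Pi , below
... | no ¬Pi = least-from P? (suc i) f below′ (subst P (+-suc i f) Pi+f)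
  where
    below′ : ∀ j → j < suc i → ¬ P j
    below′ j j<1+i with m≤n⇒m<n∨m≡n (≤-pred j<1+i)
    ... | inj₁ j<i  = below j j<i
    ... | inj₂ refl = ¬Pi

least : {P : ℕ → Set} → Decidable P → ∀ n → P n → ∃ λ k → P k × (∀ j → j < k → ¬ P j)
least P? n Pn = least-from P? 0 n (λ _ ()) Pn

module _ {p : ℕ} .{{_ : NonZero p}} (pp : Prime p) where

  order-exists : ∀ b → ¬ p ∣ b → ∃ λ o → Order b p o
  order-exists b p∤b =
    let o , (0<o , b^o≡1) , minimal = least (λ j → (0 <? j) ×-dec (b ^ j ≡mod? 1)) (p ∸ 1)
                                            (m<n⇒0<n∸m (prime>1 pp) , fermat pp b p∤b)
    in o , 0<o , ≡mod⇒[mod] b^o≡1 , λ j 0<j j<o b^j≡1 → minimal j j<o (0<j , [mod]⇒≡mod b^j≡1)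

  order-^≡1 : ∀ {b o} → Order b p o → b ^ o ≡ 1 ⟨mod p ⟩
  order-^≡1 (_ , b^o≡1 , _) = [mod]⇒≡mod b^o≡1

  order-minimal : ∀ {b o} → Order b p o → ∀ j → 0 < j → j < o → ¬ b ^ j ≡ 1 ⟨mod p ⟩
  order-minimal (_ , _ , minimal) j 0<j j<o b^j≡1 = minimal j 0<j j<o (≡mod⇒[mod] b^j≡1)

  order-∣⇒^≡1 : ∀ {b o e} → Order b p o → o ∣ e → b ^ e ≡ 1 ⟨mod p ⟩
  order-∣⇒^≡1 {b} {o} ord (divides c refl) =
    ≡mod-trans (≡⇒≡mod (trans (cong (b ^_) (*-comm c o)) (sym (^-*-assoc b o c)))) (1^-≡mod c (order-^≡1 ord))

  order-^≡1⇒∣ : ∀ {b o e} → Order b p o → b ^ e ≡ 1 ⟨mod p ⟩ → o ∣ e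
  order-^≡1⇒∣ {b} {o} {e} ord@(0<o , _) b^e≡1 = m%n≡0⇒n∣m e o remainder≡0
    where
      instance _ = >-nonZero 0<o
      b^remainder≡1 : b ^ (e % o) ≡ 1 ⟨mod p ⟩
      b^remainder≡1 = begin
        b ^ (e % o)                        ≡⟨ *-identityʳ _ ⟨
        b ^ (e % o) * 1                    ≈⟨ *-cong-mod (≡mod-refl {a = b ^ (e % o)}) (order-∣⇒^≡1 ord (n∣m*n (e / o))) ⟨
        b ^ (e % o) * b ^ (e / o * o)      ≡⟨ ^-distribˡ-+-* b (e % o) (e / o * o) ⟨
        b ^ (e % o + e / o * o)            ≡⟨ cong (b ^_) (m≡m%n+[m/n]*n e o) ⟨
        b ^ e                              ≈⟨ b^e≡1 ⟩
        1                                  ∎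
        where open ≡mod-Reasoning p
      remainder≡0 : e % o ≡ 0
      remainder≡0 with e % o | b^remainder≡1 | m%n<n e o
      ... | zero  | _      | _   = refl
      ... | suc r | b^r+1≡1 | r<o = ⊥-elim (order-minimal ord (suc r) z<s r<o b^r+1≡1)

  order-unique : ∀ {b o o′} → Order b p o → Order b p o′ → o ≡ o′
  order-unique ord ord′ = ∣-antisym (order-^≡1⇒∣ ord (order-^≡1 ord′)) (order-^≡1⇒∣ ord′ (order-^≡1 ord))

  order-resp-≡mod : ∀ {b b′ o} → b ≡ b′ ⟨mod p ⟩ → Order b p o → Order b′ p o
  order-resp-≡mod {b} {b′} {o} b≡b′ ord@(0<o , _ , _) =
    0<o , ≡mod⇒[mod] (≡mod-trans (^-cong-mod o (≡mod-sym b≡b′)) (order-^≡1 ord)) ,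
    λ j 0<j j<o b′^j≡1 → order-minimal ord j 0<j j<o (≡mod-trans (^-cong-mod j b≡b′) ([mod]⇒≡mod b′^j≡1))

  order-∣p-1 : ∀ {b o} → Order b p o → o ∣ p ∸ 1
  order-∣p-1 ord@(0<o , _) = order-^≡1⇒∣ ord (fermat pp _ (^-≡mod1⇒∤ pp 0<o (order-^≡1 ord)))

-- Roots of polynomials modulo a prime

-- Polynomials are coefficient lists, lowest degree first.
eval : List ℕ → ℕ → ℕ
eval []      x = 0
eval (a ∷ f) x = a + x * eval f x

eval-singleton : ∀ c x → eval (c ∷ []) x ≡ c
eval-singleton c x = trans (cong (c +_) (*-zeroʳ x)) (+-identityʳ c)

data Leading : List ℕ → ℕ → Set where
  leading-[_] : ∀ c → Leading (c ∷ []) c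
  leading-∷   : ∀ {a f c} → Leading f c → Leading (a ∷ f) c

Leading⇒length>0 : ∀ {f c} → Leading f c → 0 < length f
Leading⇒length>0 leading-[ _ ]  = z<s
Leading⇒length>0 (leading-∷ _) = z<s

-- The quotient of f by x - a (synthetic division).
deflate : ℕ → List ℕ → List ℕ
deflate a []              = []
deflate a (_ ∷ [])        = []
deflate a (_ ∷ f@(_ ∷ _)) = eval f a ∷ deflate a f

-- f(x) - f(a) = (x - a) g(x), with both sides moved so that no subtraction occurs.
deflate-eval : ∀ a f x → eval f x + a * eval (deflate a f) x ≡ x * eval (deflate a f) x + eval f a
deflate-eval a []       x = solve 2 (λ a x → con 0 :+ a :* con 0 := x :* con 0 :+ con 0) refl a x
deflate-eval a (c ∷ []) x = solve 3 (λ a c x → c :+ x :* con 0 :+ a :* con 0 := x :* con 0 :+ (c :+ a :* con 0)) refl a c x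
deflate-eval a (c ∷ f@(_ ∷ _)) x = begin
  c + x * F + a * (A + x * G)
    ≡⟨ solve 6 (λ c x F a A G → c :+ x :* F :+ a :* (A :+ x :* G) := c :+ a :* A :+ x :* (F :+ a :* G)) refl c x F a A G ⟩
  c + a * A + x * (F + a * G)
    ≡⟨ cong (λ z → c + a * A + x * z) (deflate-eval a f x) ⟩
  c + a * A + x * (x * G + A)
    ≡⟨ solve 6 (λ c x F a A G → c :+ a :* A :+ x :* (x :* G :+ A) := x :* (A :+ x :* G) :+ (c :+ a :* A)) refl c x F a A G ⟩
  x * (A + x * G) + (c + a * A) ∎
  where
    open ≡-Reasoning
    F = eval f x
    A = eval f a
    G = eval (deflate a f) x

length-deflate : ∀ a f → length (deflate a f) ≡ length f ∸ 1
length-deflate a []              = refl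
length-deflate a (_ ∷ [])        = refl
length-deflate a (_ ∷ f@(_ ∷ _)) = cong suc (length-deflate a f)

deflate-leading : ∀ a {b y f c} → Leading (b ∷ y ∷ f) c → Leading (deflate a (b ∷ y ∷ f)) c
deflate-leading a {y = y} {f = []} (leading-∷ leading-[ .y ]) =
  subst (λ z → Leading (z ∷ []) y) (sym (eval-singleton y a)) leading-[ y ]
deflate-leading a {f = _ ∷ _} (leading-∷ ℓ) = leading-∷ (deflate-leading a ℓ)

module _ {p : ℕ} .{{_ : NonZero p}} (pp : Prime p) where

  roots-length-< : ∀ (rs f : List ℕ) {c} → Leading f c → ¬ c ≡ 0 ⟨mod p ⟩ → Unique rs →
    (∀ {r} → r ∈ rs → r < p × eval f r ≡ 0 ⟨mod p ⟩) → length rs < length f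
  roots-length-< []       f ℓ _ _ _ = Leading⇒length>0 ℓ
  roots-length-< (a ∷ rs) (c ∷ []) leading-[ .c ] c≢0 _ roots =
    ⊥-elim (c≢0 (≡mod-trans (≡⇒≡mod (sym (eval-singleton c a))) (proj₂ (roots (here refl)))))
  roots-length-< (a ∷ rs) (b ∷ f@(_ ∷ _)) (leading-∷ ℓ) c≢0 (a∉rs ∷ !rs) roots =
    ≤-trans (s≤s (roots-length-< rs g (deflate-leading a {b} (leading-∷ ℓ)) c≢0 !rs g-roots))
            (≤-reflexive (cong suc (length-deflate a (b ∷ f))))
    where
      g = deflate a (b ∷ f)
      a<p = proj₁ (roots (here refl))
      g-roots : ∀ {r} → r ∈ rs → r < p × eval g r ≡ 0 ⟨mod p ⟩
      g-roots {r} r∈ = r<p , *-≡mod-≢⇒≡mod0 pp ag≡rg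
        (λ a≡r → All¬⇒¬Any a∉rs (subst (_∈ rs) (sym (≡mod-<⇒≡ a<p r<p a≡r)) r∈))
        where
          r<p = proj₁ (roots (there r∈))
          ag≡rg : a * eval g r ≡ r * eval g r ⟨mod p ⟩
          ag≡rg = +-cancelʳ-≡mod {c = 0} (begin
            a * eval g r + 0               ≡⟨ +-comm _ 0 ⟩
            0 + a * eval g r               ≈⟨ +-cong-mod (proj₂ (roots (there r∈))) (≡mod-refl {a = a * eval g r}) ⟨
            eval (b ∷ f) r + a * eval g r  ≡⟨ deflate-eval a (b ∷ f) r ⟩
            r * eval g r + eval (b ∷ f) a  ≈⟨ +-cong-mod (≡mod-refl {a = r * eval g r}) (proj₂ (roots (here refl))) ⟩
            r * eval g r + 0               ∎)
            where open ≡mod-Reasoning p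

  count-roots-< : ∀ f {c} → Leading f c → ¬ c ≡ 0 ⟨mod p ⟩ → count (λ x → eval f x ≡mod? 0) p < length f
  count-roots-< f ℓ c≢0 = roots-length-< (filter roots? (downFrom p)) f ℓ c≢0
    (unique-filter-downFrom roots? p) (∈-filter-downFrom⁻ roots?)
    where
      roots? = λ x → eval f x ≡mod? 0

monomial : ℕ → List ℕ
monomial zero    = 1 ∷ []
monomial (suc k) = 0 ∷ monomial k

eval-monomial : ∀ k x → eval (monomial k) x ≡ x ^ k
eval-monomial zero    x = eval-singleton 1 x
eval-monomial (suc k) x = cong (x *_) (eval-monomial k x)

monomial-leading : ∀ k → Leading (monomial k) 1
monomial-leading zero    = leading-[ 1 ]
monomial-leading (suc k) = leading-∷ (monomial-leading k)

length-monomial : ∀ k → length (monomial k) ≡ suc k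
length-monomial zero    = refl
length-monomial (suc k) = cong suc (length-monomial k)

eval-padding : ∀ j f x → eval (replicate j 0 ++ f) x ≡ x ^ j * eval f x
eval-padding zero    f x = sym (+-identityʳ _)
eval-padding (suc j) f x = trans (cong (x *_) (eval-padding j f x)) (sym (*-assoc x (x ^ j) (eval f x)))

padding-leading : ∀ j {f c} → Leading f c → Leading (replicate j 0 ++ f) c
padding-leading zero    ℓ = ℓ
padding-leading (suc j) ℓ = leading-∷ (padding-leading j ℓ)

-- 1 + x ^ d + x ^ (2 d) + ⋯ + x ^ (k d)
geometric : ℕ → ℕ → List ℕ
geometric d zero    = 1 ∷ []
geometric d (suc k) = 1 ∷ (replicate (d ∸ 1) 0 ++ geometric d k)

geometric-leading : ∀ d k → Leading (geometric d k) 1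
geometric-leading d zero    = leading-[ 1 ]
geometric-leading d (suc k) = leading-∷ (padding-leading (d ∸ 1) (geometric-leading d k))

module _ {d : ℕ} (0<d : 0 < d) where

  length-geometric : ∀ k → length (geometric d k) ≡ suc (d * k)
  length-geometric zero    = cong suc (sym (*-zeroʳ d))
  length-geometric (suc k) = begin
    suc (length (replicate (d ∸ 1) 0 ++ geometric d k))         ≡⟨ cong suc (length-++ (replicate (d ∸ 1) 0)) ⟩
    suc (length (replicate (d ∸ 1) 0) + length (geometric d k))  ≡⟨ cong₂ (λ a b → suc (a + b)) (length-replicate (d ∸ 1)) (length-geometric k) ⟩
    suc (d ∸ 1 + suc (d * k))                                    ≡⟨ cong suc (+-suc (d ∸ 1) (d * k)) ⟩
    suc (suc (d ∸ 1) + d * k)                                    ≡⟨ cong (λ z → suc (z + d * k)) (m+[n∸m]≡n 0<d) ⟩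
    suc (d + d * k)                                              ≡⟨ cong suc (*-suc d k) ⟨
    suc (d * suc k)                                              ∎
    where open ≡-Reasoning

  eval-geometric-suc : ∀ k x → eval (geometric d (suc k)) x ≡ 1 + x ^ d * eval (geometric d k) x
  eval-geometric-suc k x = cong (1 +_) (begin
    x * eval (replicate (d ∸ 1) 0 ++ geometric d k) x  ≡⟨ cong (x *_) (eval-padding (d ∸ 1) (geometric d k) x) ⟩
    x * (x ^ (d ∸ 1) * eval (geometric d k) x)         ≡⟨ *-assoc x _ _ ⟨
    x ^ (1 + (d ∸ 1)) * eval (geometric d k) x         ≡⟨ cong (λ z → x ^ z * eval (geometric d k) x) (m+[n∸m]≡n 0<d) ⟩
    x ^ d * eval (geometric d k) x                     ∎)
    where open ≡-Reasoning

  -- (y - 1) (1 + y + ⋯ + y ^ k) = y ^ (k + 1) - 1 for y = x ^ d, without subtraction.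
  geometric-telescope : ∀ k x → x ^ d * eval (geometric d k) x + 1 ≡ (x ^ d) ^ suc k + eval (geometric d k) x
  geometric-telescope zero x = begin
    y * (1 + x * 0) + 1  ≡⟨ cong (λ z → y * (1 + z) + 1) (*-zeroʳ x) ⟩
    y * 1 + 1            ≡⟨ cong (λ z → y * 1 + z) (cong (1 +_) (*-zeroʳ x)) ⟨
    y * 1 + (1 + x * 0)  ∎
    where open ≡-Reasoning ; y = x ^ d
  geometric-telescope (suc k) x rewrite eval-geometric-suc k x = begin
    y * (1 + y * G) + 1      ≡⟨ solve 2 (λ y G → y :* (con 1 :+ y :* G) :+ con 1 := y :* (y :* G :+ con 1) :+ con 1) refl y G ⟩
    y * (y * G + 1) + 1      ≡⟨ cong (λ z → y * z + 1) (geometric-telescope k x) ⟩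
    y * (y ^ suc k + G) + 1  ≡⟨ solve 3 (λ y Y G → y :* (Y :+ G) :+ con 1 := y :* Y :+ (con 1 :+ y :* G)) refl y (y ^ suc k) G ⟩
    y ^ suc (suc k) + (1 + y * G) ∎
    where
      open ≡-Reasoning
      y = x ^ d
      G = eval (geometric d k) x

module _ {p : ℕ} .{{_ : NonZero p}} (pp : Prime p) where

  private
    1<p : 1 < p
    1<p = prime>1 pp

  count-roots-of-unity-≤ : ∀ d → 0 < d → count (λ x → x ^ d ≡mod? 1) p ≤ d
  count-roots-of-unity-≤ d 0<d = ≤-pred (≤-trans
    (subst (_< length f) (count-cong _ _ p (λ _ → root⇒) (λ _ → ⇒root))
      (count-roots-< pp f (leading-∷ (monomial-leading (d ∸ 1))) (1≢0-mod 1<p)))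
    (≤-reflexive (cong suc (trans (length-monomial (d ∸ 1)) (m+[n∸m]≡n 0<d)))))
    where
      -- x ^ d - 1 with - 1 written as + (p - 1)
      f = (p ∸ 1) ∷ monomial (d ∸ 1)
      eval-f : ∀ x → eval f x ≡ p ∸ 1 + x ^ d
      eval-f x = cong (p ∸ 1 +_) (trans (cong (x *_) (eval-monomial (d ∸ 1) x)) (cong (x ^_) (m+[n∸m]≡n 0<d)))
      p-1+1≡0 : p ∸ 1 + 1 ≡ 0 ⟨mod p ⟩
      p-1+1≡0 = ≡mod-trans (≡⇒≡mod (m∸n+n≡m (<⇒≤ 1<p))) (∣⇒≡mod0 ∣-refl)
      ⇒root : ∀ {x} → x ^ d ≡ 1 ⟨mod p ⟩ → eval f x ≡ 0 ⟨mod p ⟩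
      ⇒root {x} x^d≡1 = begin
        eval f x       ≡⟨ eval-f x ⟩
        p ∸ 1 + x ^ d  ≈⟨ +-cong-mod (≡mod-refl {a = p ∸ 1}) x^d≡1 ⟩
        p ∸ 1 + 1      ≈⟨ p-1+1≡0 ⟩
        0              ∎
        where open ≡mod-Reasoning p
      root⇒ : ∀ {x} → eval f x ≡ 0 ⟨mod p ⟩ → x ^ d ≡ 1 ⟨mod p ⟩
      root⇒ {x} fx≡0 = +-cancelʳ-≡mod {c = p ∸ 1} (begin
        x ^ d + (p ∸ 1)  ≡⟨ +-comm (x ^ d) (p ∸ 1) ⟩
        p ∸ 1 + x ^ d    ≡⟨ eval-f x ⟨
        eval f x         ≈⟨ fx≡0 ⟩
        0                ≈⟨ p-1+1≡0 ⟨
        p ∸ 1 + 1        ≡⟨ +-comm (p ∸ 1) 1 ⟩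
        1 + (p ∸ 1)      ∎)
        where open ≡mod-Reasoning p

  -- Every nonzero residue is a root of x ^ d - 1 or of 1 + x ^ d + ⋯ + x ^ (k d), where p - 1 = d (k + 1),
  -- and the second polynomial has at most k d roots.
  count-roots-of-unity : ∀ d → d ∣ p ∸ 1 → count (λ x → x ^ d ≡mod? 1) p ≡ d
  count-roots-of-unity d (divides zero p-1≡0) = ⊥-elim (<⇒≢ (m<n⇒0<n∸m 1<p) (sym p-1≡0))
  count-roots-of-unity d (divides (suc k) p-1≡[k+1]d) = ≤-antisym (count-roots-of-unity-≤ d 0<d) d≤count
    where
      p-1≡d[k+1] : p ∸ 1 ≡ d * suc k
      p-1≡d[k+1] = trans p-1≡[k+1]d (*-comm (suc k) d)
      0<d : 0 < d
      0<d = n≢0⇒n>0 λ { refl → <⇒≢ (m<n⇒0<n∸m 1<p) (sym p-1≡d[k+1]) }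
      unity? = λ x → x ^ d ≡mod? 1
      G-root? = λ x → eval (geometric d k) x ≡mod? 0
      count-G-roots : count G-root? p ≤ d * k
      count-G-roots = ≤-pred (≤-trans (count-roots-< pp (geometric d k) (geometric-leading d k) (1≢0-mod 1<p))
                                      (≤-reflexive (length-geometric 0<d k)))
      unity-or-G-root : ∀ {x} → 0 < x → x < p → x ^ d ≡ 1 ⟨mod p ⟩ ⊎ eval (geometric d k) x ≡ 0 ⟨mod p ⟩
      unity-or-G-root {x} 0<x x<p with unity? x
      ... | yes x^d≡1 = inj₁ x^d≡1
      ... | no  x^d≢1 = inj₂ (*-≡mod-≢⇒≡mod0 pp x^dG≡G x^d≢1)
        where
          G = eval (geometric d k) x
          x^d[k+1]≡1 : (x ^ d) ^ suc k ≡ 1 ⟨mod p ⟩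
          x^d[k+1]≡1 = begin
            (x ^ d) ^ suc k  ≡⟨ ^-*-assoc x d (suc k) ⟩
            x ^ (d * suc k)  ≡⟨ cong (x ^_) p-1≡d[k+1] ⟨
            x ^ (p ∸ 1)      ≈⟨ fermat pp x (λ p∣x → <⇒≱ x<p (∣⇒≤ {{>-nonZero 0<x}} p∣x)) ⟩
            1                ∎
            where open ≡mod-Reasoning p
          x^dG≡G : x ^ d * G ≡ 1 * G ⟨mod p ⟩
          x^dG≡G = +-cancelʳ-≡mod {c = 1} (begin
            x ^ d * G + 1        ≡⟨ geometric-telescope 0<d k x ⟩
            (x ^ d) ^ suc k + G  ≈⟨ +-cong-mod x^d[k+1]≡1 (≡mod-refl {a = G}) ⟩
            1 + G                ≡⟨ +-comm 1 G ⟩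
            G + 1                ≡⟨ cong (_+ 1) (*-identityˡ G) ⟨
            1 * G + 1            ∎)
            where open ≡mod-Reasoning p
      d≤count : d ≤ count unity? p
      d≤count = +-cancelʳ-≤ (d * k) d (count unity? p) (begin
        d + d * k                                      ≡⟨ *-suc d k ⟨
        d * suc k                                      ≡⟨ p-1≡d[k+1] ⟨
        p ∸ 1                                          ≤⟨ count-≥-pred (λ x → unity? x ⊎-dec G-root? x) p unity-or-G-root ⟩
        count (λ x → unity? x ⊎-dec G-root? x) p       ≤⟨ count-⊎-≤ unity? G-root? p ⟩
        count unity? p + count G-root? p               ≤⟨ +-monoʳ-≤ (count unity? p) count-G-roots ⟩
        count unity? p + d * k                         ∎)
        where open ≤-Reasoning

-- Divisibility by powers of q

prime∤1 : ∀ {p} → Prime p → ¬ p ∣ 1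
prime∤1 pp p∣1 = ¬prime[1] (subst Prime (∣1⇒≡1 p∣1) pp)

prime∤⇒coprime : ∀ {q n} → Prime q → ¬ q ∣ n → Coprime q n
prime∤⇒coprime qp q∤n (d∣q , d∣n) with prime⇒irreducible qp d∣q
... | inj₁ d≡1    = d≡1
... | inj₂ refl = ⊥-elim (q∤n d∣n)

coprime⇒∤ : ∀ {q t} → Prime q → Coprime q t → ¬ q ∣ t
coprime⇒∤ qp q⊥t q∣t = <⇒≢ (prime>1 qp) (sym (q⊥t (∣-refl , q∣t)))

coprime-* : ∀ {a b c} → Coprime a b → Coprime a c → Coprime a (b * c)
coprime-* a⊥b a⊥c (d∣a , d∣bc) = a⊥c (d∣a , coprime-divisor (λ (e∣d , e∣b) → a⊥b (∣-trans e∣d d∣a , e∣b)) d∣bc)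

coprime-^ : ∀ {a b} → Coprime a b → ∀ j → Coprime a (b ^ j)
coprime-^ a⊥b zero    (_ , d∣1) = ∣1⇒≡1 d∣1
coprime-^ a⊥b (suc j) = coprime-* a⊥b (coprime-^ a⊥b j)

gcd-coprime-* : ∀ {t c} u → Coprime t c → gcd t (c * u) ≡ gcd t u
gcd-coprime-* {t} {c} u t⊥c = ∣-antisym
  (gcd-greatest (gcd[m,n]∣m t (c * u)) (coprime-divisor gcd⊥c (gcd[m,n]∣n t (c * u))))
  (gcd-greatest (gcd[m,n]∣m t u) (∣n⇒∣m*n c (gcd[m,n]∣n t u)))
  where
    gcd⊥c : Coprime (gcd t (c * u)) c
    gcd⊥c (d∣gcd , d∣c) = t⊥c (∣-trans d∣gcd (gcd[m,n]∣m t (c * u)) , d∣c)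

^-∣-^ : ∀ q {a b} → a ≤ b → q ^ a ∣ q ^ b
^-∣-^ q {a} {b} a≤b = divides (q ^ (b ∸ a)) (trans (cong (q ^_) (sym (m∸n+n≡m a≤b))) (^-distribˡ-+-* q (b ∸ a) a))

module _ {q t : ℕ} (qp : Prime q) (q⊥t : Coprime q t) where

  private instance
    q≢0 : NonZero q
    q≢0 = prime⇒nonZero qp

  q^[j+1]∤q^j*t : ∀ j → ¬ q ^ suc j ∣ q ^ j * t
  q^[j+1]∤q^j*t j q^[j+1]∣ = coprime⇒∤ qp q⊥t
    (*-cancelˡ-∣ (q ^ j) {{m^n≢0 q j}} (subst (_∣ q ^ j * t) (*-comm q (q ^ j)) q^[j+1]∣))

  ∣q^s*t⇒∣q^j*t : ∀ s j n → n ∣ q ^ s * t → ¬ q ^ suc j ∣ n → n ∣ q ^ j * t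
  ∣q^s*t⇒∣q^j*t zero    j n n∣t _ = ∣n⇒∣m*n (q ^ j) (subst (n ∣_) (+-identityʳ t) n∣t)
  ∣q^s*t⇒∣q^j*t (suc s) j n n∣ q^[j+1]∤n with q ∣? n
  ... | no q∤n = ∣q^s*t⇒∣q^j*t s j n
        (coprime-divisor (Coprime.sym (prime∤⇒coprime qp q∤n)) (subst (n ∣_) (*-assoc q (q ^ s) t) n∣)) q^[j+1]∤n
  ... | yes (divides n′ refl) with j
  ...   | zero   = ⊥-elim (q^[j+1]∤n (subst (_∣ n′ * q) (sym (*-identityʳ q)) (n∣m*n n′)))
  ...   | suc j′ = subst (_∣ q ^ suc j′ * t) (*-comm q n′)
            (subst (q * n′ ∣_) (sym (*-assoc q (q ^ j′) t)) (*-monoʳ-∣ q n′∣q^j′t))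
    where
      n′∣q^j′t : n′ ∣ q ^ j′ * t
      n′∣q^j′t = ∣q^s*t⇒∣q^j*t s j′ n′
        (*-cancelˡ-∣ q (subst₂ _∣_ (*-comm n′ q) (*-assoc q (q ^ s) t) n∣))
        (λ q^[j′+1]∣n′ → q^[j+1]∤n (subst (q ^ suc (suc j′) ∣_) (*-comm q n′) (*-monoʳ-∣ q q^[j′+1]∣n′)))

  gcd[q^j*t,n]≡q^j*gcd[n,t] : ∀ j n → q ^ j ∣ n → gcd (q ^ j * t) n ≡ q ^ j * gcd n t
  gcd[q^j*t,n]≡q^j*gcd[n,t] j n (divides u refl) = begin
    gcd (q ^ j * t) (u * q ^ j)    ≡⟨ cong (gcd (q ^ j * t)) (*-comm u (q ^ j)) ⟩
    gcd (q ^ j * t) (q ^ j * u)    ≡⟨ c*gcd[m,n]≡gcd[cm,cn] (q ^ j) t u ⟨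
    q ^ j * gcd t u                ≡⟨ cong (q ^ j *_) (gcd-coprime-* u (coprime-^ (Coprime.sym q⊥t) j)) ⟨
    q ^ j * gcd t (q ^ j * u)      ≡⟨ cong (λ z → q ^ j * gcd t z) (*-comm (q ^ j) u) ⟩
    q ^ j * gcd t (u * q ^ j)      ≡⟨ cong (q ^ j *_) (gcd-comm t (u * q ^ j)) ⟩
    q ^ j * gcd (u * q ^ j) t      ∎
    where open ≡-Reasoning

-- Counting at a single prime

φ[_^_] : ℕ → ℕ → ℕ
φ[ q ^ zero  ] = 1
φ[ q ^ suc j ] = (q ∸ 1) * q ^ j

Val? : ∀ q k o → Dec (Val q o k)
Val? q k o = (q ^ k ∣? o) ×-dec ¬? (q ^ suc k ∣? o)

Val-unique : ∀ {q o k k′} → Val q o k → Val q o k′ → k ≡ k′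
Val-unique {q} {o} {k} {k′} (q^k∣o , q^[k+1]∤o) (q^k′∣o , q^[k′+1]∤o) with <-cmp k k′
... | tri< k<k′ _ _ = ⊥-elim (q^[k+1]∤o (∣-trans (^-∣-^ q k<k′) q^k′∣o))
... | tri≈ _ k≡k′ _ = k≡k′
... | tri> _ _ k>k′ = ⊥-elim (q^[k′+1]∤o (∣-trans (^-∣-^ q k>k′) q^k∣o))

-- Vacuous when p ∣ x, where x has no order.
OrderSatisfies : ℕ → (ℕ → Set) → ℕ → Set
OrderSatisfies p V x = ∀ o → Order x p o → V o

module _ {p : ℕ} .{{_ : NonZero p}} (pp : Prime p) where

  orderSatisfies? : {V : ℕ → Set} → Decidable V → Decidable (OrderSatisfies p V)
  orderSatisfies? {V} V? x with p ∣? x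
  ... | yes p∣x = yes (λ o ord → ⊥-elim (^-≡mod1⇒∤ pp (proj₁ ord) (order-^≡1 pp ord) p∣x))
  ... | no p∤x = let o , ord = order-exists pp x p∤x in
    map′ (λ Vo o′ ord′ → subst V (order-unique pp ord ord′) Vo) (λ all → all o ord) (V? o)

  orderSatisfies-resp-≡mod : ∀ {V x y} → x ≡ y ⟨mod p ⟩ → OrderSatisfies p V x → OrderSatisfies p V y
  orderSatisfies-resp-≡mod x≡y all o ord = all o (order-resp-≡mod pp (≡mod-sym x≡y) ord)

module LocalCount {q t s m : ℕ} (qp : Prime q) (q⊥t : Coprime q t) (m≡q^s*t : m ≡ q ^ s * t) where

  0<m : 0 < m
  0<m = subst (0 <_) (sym m≡q^s*t) (*-mono-≤ (m^n>0 q {{prime⇒nonZero qp}} s) 0<t)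
    where
      0<t : 0 < t
      0<t = n≢0⇒n>0 λ { refl → coprime⇒∤ qp q⊥t (q ∣0) }

  Level : ℕ → ℕ → ℕ → Set
  Level k p = OrderSatisfies p (λ o → Val q o k)

  module _ {p : ℕ} .{{_ : NonZero p}} (pp : Prime p) where

    level? : ∀ k → Decidable (Level k p)
    level? k = orderSatisfies? pp (Val? q k)

    rootAtLevel? : ∀ k → Decidable (λ x → x ^ m ≡ 1 ⟨mod p ⟩ × Level k p x)
    rootAtLevel? k x = x ^ m ≡mod? 1 ×-dec level? k x

    private
      rootBelow? : ∀ j → Decidable (λ x → x ^ m ≡ 1 ⟨mod p ⟩ × OrderSatisfies p (λ o → ¬ q ^ suc j ∣ o) x)
      rootBelow? j x = x ^ m ≡mod? 1 ×-dec orderSatisfies? pp (λ o → ¬? (q ^ suc j ∣? o)) x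

      order-of-root : ∀ {x e} → 0 < e → x ^ e ≡ 1 ⟨mod p ⟩ → ∃ λ o → Order x p o
      order-of-root 0<e x^e≡1 = order-exists pp _ (^-≡mod1⇒∤ pp 0<e x^e≡1)

      -- x ^ m ≡ 1 with ν_q (|x|_p) ≤ j  iff  x ^ gcd (q ^ j t) (p - 1) ≡ 1
      count-rootBelow-gcd : ∀ j → j ≤ s → count (rootBelow? j) p ≡ gcd (q ^ j * t) (p ∸ 1)
      count-rootBelow-gcd j j≤s = trans (count-cong (rootBelow? j) (λ x → x ^ D ≡mod? 1) p (λ _ → ⇒root) (λ _ → root⇒))
        (count-roots-of-unity pp D (gcd[m,n]∣n (q ^ j * t) (p ∸ 1)))
        where
          D = gcd (q ^ j * t) (p ∸ 1)
          0<D : 0 < D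
          0<D = n≢0⇒n>0 λ D≡0 → <⇒≢ (m<n⇒0<n∸m (prime>1 pp)) (sym (gcd[m,n]≡0⇒n≡0 (q ^ j * t) D≡0))
          ⇒root : ∀ {x} → x ^ m ≡ 1 ⟨mod p ⟩ × OrderSatisfies p (λ o → ¬ q ^ suc j ∣ o) x → x ^ D ≡ 1 ⟨mod p ⟩
          ⇒root (x^m≡1 , below) = let o , ord = order-of-root 0<m x^m≡1 in
            order-∣⇒^≡1 pp ord (gcd-greatest
              (∣q^s*t⇒∣q^j*t qp q⊥t s j o (subst (o ∣_) m≡q^s*t (order-^≡1⇒∣ pp ord x^m≡1)) (below o ord))
              (order-∣p-1 pp ord))
          root⇒ : ∀ {x} → x ^ D ≡ 1 ⟨mod p ⟩ → x ^ m ≡ 1 ⟨mod p ⟩ × OrderSatisfies p (λ o → ¬ q ^ suc j ∣ o) x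
          root⇒ {x} x^D≡1 = order-∣⇒^≡1 pp ord o∣m ,
            λ o′ ord′ q^[j+1]∣o′ → q^[j+1]∤q^j*t qp q⊥t j
              (∣-trans (subst (q ^ suc j ∣_) (order-unique pp ord′ ord) q^[j+1]∣o′) o∣q^jt)
            where
              o : ℕ
              o = proj₁ (order-of-root 0<D x^D≡1)
              ord : Order x p o
              ord = proj₂ (order-of-root 0<D x^D≡1)
              o∣q^jt : o ∣ q ^ j * t
              o∣q^jt = ∣-trans (order-^≡1⇒∣ pp ord x^D≡1) (gcd[m,n]∣m (q ^ j * t) (p ∸ 1))
              o∣m : o ∣ m
              o∣m = subst (o ∣_) (sym m≡q^s*t) (∣-trans o∣q^jt (*-monoˡ-∣ t (^-∣-^ q j≤s)))

      count-rootBelow-q^j : ∀ j → j ≤ s → q ^ j ∣ p ∸ 1 → count (rootBelow? j) p ≡ q ^ j * gcd (p ∸ 1) t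
      count-rootBelow-q^j j j≤s q^j∣p-1 = trans (count-rootBelow-gcd j j≤s) (gcd[q^j*t,n]≡q^j*gcd[n,t] qp q⊥t j (p ∸ 1) q^j∣p-1)

    count-level : ∀ k → k ≤ s → q ^ k ∣ p ∸ 1 → count (rootAtLevel? k) p ≡ φ[ q ^ k ] * gcd (p ∸ 1) t
    count-level zero _ _ = trans
      (count-cong (rootAtLevel? 0) (rootBelow? 0) p
        (λ _ (x^m≡1 , level) → x^m≡1 , λ o ord → proj₂ (level o ord))
        (λ _ (x^m≡1 , below) → x^m≡1 , λ o ord → 1∣ o , below o ord))
      (count-rootBelow-q^j 0 z≤n (1∣ (p ∸ 1)))
    count-level (suc j) j<s q^[j+1]∣p-1 = begin
      count (rootAtLevel? (suc j)) p                        ≡⟨ m+n∸n≡m _ (q ^ j * g) ⟨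
      count (rootAtLevel? (suc j)) p + q ^ j * g ∸ q ^ j * g ≡⟨ cong (_∸ q ^ j * g) split ⟩
      q ^ suc j * g ∸ q ^ j * g                             ≡⟨ *-distribʳ-∸ g (q ^ suc j) (q ^ j) ⟨
      (q * q ^ j ∸ q ^ j) * g                               ≡⟨ cong (λ z → (q * q ^ j ∸ z) * g) (*-identityˡ (q ^ j)) ⟨
      (q * q ^ j ∸ 1 * q ^ j) * g                           ≡⟨ cong (_* g) (*-distribʳ-∸ (q ^ j) q 1) ⟨
      (q ∸ 1) * q ^ j * g                                   ∎
      where
        open ≡-Reasoning
        g = gcd (p ∸ 1) t
        divisible? = orderSatisfies? pp (λ o → q ^ suc j ∣? o)
        q^[j+1]∣q^[j+2] : q ^ suc j ∣ q ^ suc (suc j)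
        q^[j+1]∣q^[j+2] = divides q refl
        rootBelow∧divisible? = λ x → rootBelow? (suc j) x ×-dec divisible? x
        rootBelow∧indivisible? = λ x → rootBelow? (suc j) x ×-dec ¬? (divisible? x)
        level≡divisible : count (rootAtLevel? (suc j)) p ≡ count rootBelow∧divisible? p
        level≡divisible = count-cong _ _ p
          (λ _ (x^m≡1 , level) → (x^m≡1 , λ o ord → proj₂ (level o ord)) , λ o ord → proj₁ (level o ord))
          (λ _ ((x^m≡1 , below) , divisible) → x^m≡1 , λ o ord → divisible o ord , below o ord)
        below≡indivisible : count (rootBelow? j) p ≡ count rootBelow∧indivisible? p
        below≡indivisible = count-cong _ _ p
          (λ {x} _ (x^m≡1 , below) → (x^m≡1 , λ o ord q^[j+2]∣o → below o ord (∣-trans q^[j+1]∣q^[j+2] q^[j+2]∣o)) ,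
             λ divisible → let o , ord = order-of-root 0<m x^m≡1 in below o ord (divisible o ord))
          (λ _ ((x^m≡1 , _) , indivisible) → x^m≡1 , λ o ord q^[j+1]∣o →
             indivisible λ o′ ord′ → subst (q ^ suc j ∣_) (order-unique pp ord ord′) q^[j+1]∣o)
        split : count (rootAtLevel? (suc j)) p + q ^ j * g ≡ q ^ suc j * g
        split = begin
          count (rootAtLevel? (suc j)) p + q ^ j * g
            ≡⟨ cong₂ _+_ level≡divisible
                 (trans (sym (count-rootBelow-q^j j (<⇒≤ j<s) (∣-trans (divides q refl) q^[j+1]∣p-1))) below≡indivisible) ⟩
          count rootBelow∧divisible? p + count rootBelow∧indivisible? p
            ≡⟨ count-split (rootBelow? (suc j)) divisible? p ⟨
          count (rootBelow? (suc j)) p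
            ≡⟨ count-rootBelow-q^j (suc j) j<s q^[j+1]∣p-1 ⟩
          q ^ suc j * g ∎

-- Hensel lifting and the Chinese remainder theorem

geometricSum : ℕ → ℕ → ℕ
geometricSum u zero    = 0
geometricSum u (suc n) = u ^ n + geometricSum u n

geometricSum-telescope : ∀ u n → u * geometricSum u n + 1 ≡ geometricSum u n + u ^ n
geometricSum-telescope u zero    = cong (_+ 1) (*-zeroʳ u)
geometricSum-telescope u (suc n) = begin
  u * (u ^ n + S) + 1      ≡⟨ solve 3 (λ u U S → u :* (U :+ S) :+ con 1 := u :* U :+ (u :* S :+ con 1)) refl u (u ^ n) S ⟩
  u * u ^ n + (u * S + 1)  ≡⟨ cong (u * u ^ n +_) (geometricSum-telescope u n) ⟩
  u * u ^ n + (S + u ^ n)  ≡⟨ solve 3 (λ uU S U → uU :+ (S :+ U) := U :+ S :+ uU) refl (u * u ^ n) S (u ^ n) ⟩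
  u ^ n + S + u * u ^ n    ∎
  where
    open ≡-Reasoning
    S = geometricSum u n

geometricSum-≡mod : ∀ {M} .{{_ : NonZero M}} {u} → u ≡ 1 ⟨mod M ⟩ → ∀ n → geometricSum u n ≡ n ⟨mod M ⟩
geometricSum-≡mod u≡1 zero    = ≡mod-refl
geometricSum-≡mod u≡1 (suc n) = +-cong-mod (1^-≡mod n u≡1) (geometricSum-≡mod u≡1 n)

-- u ^ p - 1 = (u - 1) (1 + u + ⋯ + u ^ (p - 1)), and both factors are divisible: by M and by p.
^-prime-lift : ∀ {p M} .{{_ : NonZero p}} .{{_ : NonZero M}} .{{_ : NonZero (p * M)}} → Prime p → p ∣ M →
  ∀ {u} → u ≡ 1 ⟨mod M ⟩ → u ^ p ≡ 1 ⟨mod p * M ⟩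
^-prime-lift {p} {M} pp p∣M {u} u≡1 = ≡mod-trans (≡⇒≡mod u^p≡) (mk≡mod (%-remove-+ʳ 1 pM∣[u-1]S))
  where
    S = geometricSum u p
    1≤u : 1 ≤ u
    1≤u = n≢0⇒n>0 λ { refl → <⇒≱ (prime>1 pp) (≤-trans (∣⇒≤ p∣M) (∣⇒≤ (≡mod⇒∣∣-∣ u≡1))) }
    u^p≡ : u ^ p ≡ 1 + (u ∸ 1) * S
    u^p≡ = +-cancelˡ-≡ S _ _ (begin
      S + u ^ p                  ≡⟨ geometricSum-telescope u p ⟨
      u * S + 1                  ≡⟨ cong (λ z → z * S + 1) (m+[n∸m]≡n 1≤u) ⟨
      (1 + (u ∸ 1)) * S + 1      ≡⟨ solve 2 (λ v S → (con 1 :+ v) :* S :+ con 1 := S :+ (con 1 :+ v :* S)) refl (u ∸ 1) S ⟩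
      S + (1 + (u ∸ 1) * S)      ∎)
      where open ≡-Reasoning
    M∣u-1 : M ∣ u ∸ 1
    M∣u-1 = subst (M ∣_) (m≤n⇒∣n-m∣≡n∸m 1≤u) (≡mod⇒∣∣-∣ u≡1)
    p∣S : p ∣ S
    p∣S = ≡mod0⇒∣ (≡mod-trans (≡mod-∣ p∣M (geometricSum-≡mod u≡1 p)) (∣⇒≡mod0 ∣-refl))
    pM∣[u-1]S : p * M ∣ (u ∸ 1) * S
    pM∣[u-1]S = subst (_∣ (u ∸ 1) * S) (*-comm M p) (*-pres-∣ M∣u-1 p∣S)

-- An exponent e with p e ≡ 1 (mod m), in the form p e + m K = 1 + m L.
inverse-exponent : ∀ {p m} → 0 < m → Coprime p m → ∃ λ e → ∃ λ K → ∃ λ L → p * e + m * K ≡ 1 + m * L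
inverse-exponent {p} {m} 0<m p⊥m with coprime-Bézout p⊥m
... | Bézout.+- x y 1+ym≡xp = x , 0 , y , (begin
  p * x + m * 0  ≡⟨ solve 3 (λ p x m → p :* x :+ m :* con 0 := x :* p) refl p x m ⟩
  x * p          ≡⟨ 1+ym≡xp ⟨
  1 + y * m      ≡⟨ cong (1 +_) (*-comm y m) ⟩
  1 + m * y      ∎)
  where open ≡-Reasoning
... | Bézout.-+ x y 1+xp≡ym with m | 0<m
...   | suc n | _ = x * n , 1 , y * n , (begin
  p * (x * n) + suc n * 1   ≡⟨ solve 3 (λ p x n → p :* (x :* n) :+ (con 1 :+ n) :* con 1 := con 1 :+ (con 1 :+ x :* p) :* n) refl p x n ⟩
  1 + (1 + x * p) * n       ≡⟨ cong (λ z → 1 + z * n) 1+xp≡ym ⟩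
  1 + y * suc n * n         ≡⟨ solve 2 (λ y n → con 1 :+ y :* (con 1 :+ n) :* n := con 1 :+ (con 1 :+ n) :* (y :* n)) refl y n ⟩
  1 + suc n * (y * n)       ∎)
  where open ≡-Reasoning

module _ {p M : ℕ} .{{_ : NonZero p}} .{{_ : NonZero M}} .{{_ : NonZero (p * M)}} (pp : Prime p) (p∣M : p ∣ M)
         {m : ℕ} (0<m : 0 < m) (p⊥m : Coprime p m) where

  private
    ^-swap : ∀ c a b → (c ^ a) ^ b ≡ (c ^ b) ^ a
    ^-swap c a b = trans (^-*-assoc c a b) (trans (cong (c ^_) (*-comm a b)) (sym (^-*-assoc c b a)))

    ^pe≡ : ∀ {n} .{{_ : NonZero n}} {u e K L} → p * e + m * K ≡ 1 + m * L → u ^ m ≡ 1 ⟨mod n ⟩ → u ^ (p * e) ≡ u ⟨mod n ⟩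
    ^pe≡ {u = u} {e} {K} {L} eq u^m≡1 = ≡mod-trans (^-periodic {c = u} {m = m} u^m≡1 (p * e) 1 K L eq) (≡⇒≡mod (*-identityʳ u))

  root-lift : ∀ {c} → c ^ m ≡ 1 ⟨mod M ⟩ → ∃ λ b → b ≡ c ⟨mod M ⟩ × b ^ m ≡ 1 ⟨mod p * M ⟩
  root-lift {c} c^m≡1 with inverse-exponent 0<m p⊥m
  ... | e , K , L , pe≡1 = c ^ (p * e) , ^pe≡ pe≡1 c^m≡1 ,
    ≡mod-trans (≡⇒≡mod (trans (^-swap c (p * e) m) (sym (^-*-assoc (c ^ m) p e))))
      (1^-≡mod e (^-prime-lift pp p∣M c^m≡1))

  root-lift-unique : ∀ {b b′} → b ^ m ≡ 1 ⟨mod p * M ⟩ → b′ ^ m ≡ 1 ⟨mod p * M ⟩ → b ≡ b′ ⟨mod M ⟩ → b ≡ b′ ⟨mod p * M ⟩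
  root-lift-unique {b} {b′} b^m≡1 b′^m≡1 b≡b′ with inverse-exponent 0<m p⊥m
  ... | e , K , L , pe≡1 = begin
    b             ≡⟨ *-identityʳ b ⟨
    b * 1         ≈⟨ *-cong-mod (≡mod-refl {a = b}) b′z≡1 ⟨
    b * (b′ * z)  ≡⟨ x∙yz≈y∙xz b b′ z ⟩
    b′ * u        ≈⟨ *-cong-mod (≡mod-refl {a = b′}) u≡1 ⟩
    b′ * 1        ≡⟨ *-identityʳ b′ ⟩
    b′            ∎
    where
      open ≡mod-Reasoning (p * M)
      z = b′ ^ (m ∸ 1)
      b′z≡b′^m : b′ * z ≡ b′ ^ m
      b′z≡b′^m = cong (b′ ^_) (m+[n∸m]≡n 0<m)
      b′z≡1 : b′ * z ≡ 1 ⟨mod p * M ⟩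
      b′z≡1 = ≡mod-trans (≡⇒≡mod b′z≡b′^m) b′^m≡1
      -- u = b b′ ^ (m - 1) is an m-th root of unity mod p M that is ≡ 1 mod M, hence ≡ 1 mod p M
      u = b * z
      u≡1-mod-M : u ≡ 1 ⟨mod M ⟩
      u≡1-mod-M = ≡mod-trans (*-cong-mod b≡b′ ≡mod-refl) (≡mod-∣ (n∣m*n p) b′z≡1)
      u^m≡1 : u ^ m ≡ 1 ⟨mod p * M ⟩
      u^m≡1 = begin
        (b * z) ^ m         ≡⟨ ^-distribʳ-* b z m ⟩
        b ^ m * z ^ m       ≈⟨ *-cong-mod b^m≡1 (≡mod-refl {a = z ^ m}) ⟩
        1 * z ^ m           ≡⟨ *-identityˡ (z ^ m) ⟩
        (b′ ^ (m ∸ 1)) ^ m  ≡⟨ ^-swap b′ (m ∸ 1) m ⟩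
        (b′ ^ m) ^ (m ∸ 1)  ≈⟨ 1^-≡mod (m ∸ 1) b′^m≡1 ⟩
        1                   ∎
      u≡1 : u ≡ 1 ⟨mod p * M ⟩
      u≡1 = begin
        u            ≈⟨ ^pe≡ pe≡1 u^m≡1 ⟨
        u ^ (p * e)  ≡⟨ ^-*-assoc u p e ⟨
        (u ^ p) ^ e  ≈⟨ 1^-≡mod e (^-prime-lift pp p∣M u≡1-mod-M) ⟩
        1            ∎

prime∣p*M⇒≡∨∣ : ∀ {p p′ M} → Prime p → Prime p′ → p′ ∣ p * M → p′ ≡ p ⊎ p′ ∣ M
prime∣p*M⇒≡∨∣ {p} {p′} {M} pp pp′ p′∣pM with euclidsLemma p M pp′ p′∣pM
... | inj₂ p′∣M = inj₂ p′∣M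
... | inj₁ p′∣p with prime⇒irreducible pp p′∣p
...   | inj₁ refl    = ⊥-elim (prime∤1 pp′ ∣-refl)
...   | inj₂ p′≡p = inj₁ p′≡p

module _ {p M : ℕ} (pp : Prime p) where

  PrimeDivisorList-*-∣ : ∀ {ps} → p ∣ M → PrimeDivisorList (p * M) ps → PrimeDivisorList M ps
  PrimeDivisorList-*-∣ p∣M (!ps , ps⇔) = !ps , λ x → mk⇔
    (λ x∈ → let xp , x∣pM = Equivalence.to (ps⇔ x) x∈ in xp , ∣M xp x∣pM)
    (λ (xp , x∣M) → Equivalence.from (ps⇔ x) (xp , ∣-trans x∣M (n∣m*n p)))
    where
      ∣M : ∀ {x} → Prime x → x ∣ p * M → x ∣ M
      ∣M xp x∣pM with prime∣p*M⇒≡∨∣ pp xp x∣pM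
      ... | inj₁ refl = p∣M
      ... | inj₂ x∣M  = x∣M

  PrimeDivisorList-*-∤ : ∀ {ps} → ¬ p ∣ M → PrimeDivisorList (p * M) ps →
    PrimeDivisorList M (filter (λ x → ¬? (x ≟ p)) ps)
  PrimeDivisorList-*-∤ p∤M (!ps , ps⇔) = Unique.filter⁺ ≢p? !ps , λ x → mk⇔
    (λ x∈ → let x∈ps , x≢p = ∈-filter⁻ ≢p? x∈ ; xp , x∣pM = Equivalence.to (ps⇔ x) x∈ps in xp , ∣M xp x∣pM x≢p)
    (λ (xp , x∣M) → ∈-filter⁺ ≢p? (Equivalence.from (ps⇔ x) (xp , ∣-trans x∣M (n∣m*n p))) λ { refl → p∤M x∣M })
    where
      ≢p? = λ x → ¬? (x ≟ p)
      ∣M : ∀ {x} → Prime x → x ∣ p * M → x ≢ p → x ∣ M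
      ∣M xp x∣pM x≢p with prime∣p*M⇒≡∨∣ pp xp x∣pM
      ... | inj₁ x≡p = ⊥-elim (x≢p x≡p)
      ... | inj₂ x∣M = x∣M

product-map-remove : ∀ (f : ℕ → ℕ) {p} ps → Unique ps → p ∈ ps →
  product (map f ps) ≡ f p * product (map f (filter (λ x → ¬? (x ≟ p)) ps))
product-map-remove f {p} (x ∷ xs) (x∉xs ∷ _) (here refl) =
  cong (λ l → f x * product (map f l)) (sym (trans (filter-reject ≢p? (λ x≢x → x≢x refl)) (filter-all ≢p? (≢x x∉xs))))
  where
    ≢p? = λ y → ¬? (y ≟ p)
    ≢x : ∀ {ys} → All (x ≢_) ys → All (_≢ x) ys
    ≢x []             = []
    ≢x (x≢y ∷ x∉ys) = (λ y≡x → x≢y (sym y≡x)) ∷ ≢x x∉ys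
product-map-remove f {p} (x ∷ xs) (x∉xs ∷ !xs) (there p∈xs) with x ≟ p
... | yes refl = ⊥-elim (All¬⇒¬Any x∉xs p∈xs)
... | no x≢p = begin
  f x * product (map f xs)                ≡⟨ cong (f x *_) (product-map-remove f xs !xs p∈xs) ⟩
  f x * (f p * product (map f (rm xs)))   ≡⟨ x∙yz≈y∙xz (f x) (f p) _ ⟩
  f p * (f x * product (map f (rm xs)))   ≡⟨ cong (λ l → f p * product (map f l)) (filter-accept (λ y → ¬? (y ≟ p)) x≢p) ⟨
  f p * product (map f (rm (x ∷ xs)))     ∎
  where
    open ≡-Reasoning
    rm = filter (λ y → ¬? (y ≟ p))

-- Counting m-th roots of unity modulo M with a condition R at each prime of M reduces to single
-- primes when no prime of M divides m.
module LocalGlobal (m : ℕ) (0<m : 0 < m) (R : ℕ → ℕ → Set)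
  (R? : ∀ {p} .{{_ : NonZero p}} → Prime p → Decidable (R p))
  (R-resp : ∀ {p} .{{_ : NonZero p}} → Prime p → ∀ {x y} → x ≡ y ⟨mod p ⟩ → R p x → R p y) where

  Good : (M : ℕ) .{{_ : NonZero M}} → ℕ → Set
  Good M b = b ^ m ≡ 1 ⟨mod M ⟩ × (∀ p → Prime p → p ∣ M → R p b)

  good? : ∀ M .{{_ : NonZero M}} → Decidable (Good M)
  good? M b = b ^ m ≡mod? 1 ×-dec all?
    where
      atPrime? : ∀ i → Dec (Prime i → i ∣ M → R i b)
      atPrime? i with prime? i | i ∣? M
      ... | no ¬ip | _ = yes (λ ip → ⊥-elim (¬ip ip))
      ... | yes ip | no i∤M = yes (λ _ i∣M → ⊥-elim (i∤M i∣M))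
      ... | yes ip | yes i∣M with R? {{prime⇒nonZero ip}} ip b
      ...   | yes Rib = yes (λ _ _ → Rib)
      ...   | no ¬Rib = no (λ every → ¬Rib (every ip i∣M))
      all? : Dec (∀ p → Prime p → p ∣ M → R p b)
      all? with allUpTo? atPrime? (suc M)
      ... | yes below = yes (λ p pp p∣M → below (s≤s (∣⇒≤ p∣M)) pp p∣M)
      ... | no ¬below = no (λ every → ¬below (λ {i} _ → every i))

  localGood? : ∀ {p} .{{_ : NonZero p}} → Prime p → Decidable (λ x → x ^ m ≡ 1 ⟨mod p ⟩ × R p x)
  localGood? pp x = x ^ m ≡mod? 1 ×-dec R? pp x

  module _ {p M : ℕ} .{{_ : NonZero p}} .{{_ : NonZero M}} .{{_ : NonZero (p * M)}} (pp : Prime p) where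

    private
      M∣pM : M ∣ p * M
      M∣pM = n∣m*n p

      R-resp-∣ : ∀ {p′ K} .{{_ : NonZero K}} → Prime p′ → p′ ∣ K → ∀ {x y} → x ≡ y ⟨mod K ⟩ → R p′ x → R p′ y
      R-resp-∣ pp′ p′∣K x≡y = R-resp {{prime⇒nonZero pp′}} pp′ (≡mod-∣ {{prime⇒nonZero pp′}} p′∣K x≡y)

      good-%M : ∀ {b} → Good (p * M) b → Good M (b % M)
      good-%M {b} (b^m≡1 , R-all) = ≡mod-trans (^-cong-mod m (%-≡mod b)) (≡mod-∣ M∣pM b^m≡1) ,
        λ p′ pp′ p′∣M → R-resp-∣ pp′ p′∣M (≡mod-sym (%-≡mod b)) (R-all p′ pp′ (∣-trans p′∣M M∣pM))

    count-good-hensel : p ∣ M → ¬ p ∣ m → count (good? (p * M)) (p * M) ≡ count (good? M) M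
    count-good-hensel p∣M p∤m = count-bijection (good? (p * M)) (good? M) (p * M) M (_% M)
      (λ {b} _ good → m%n<n b M , good-%M good)
      (λ x< y< (x^m≡1 , _) (y^m≡1 , _) x%M≡y%M →
         ≡mod-<⇒≡ x< y< (root-lift-unique pp p∣M 0<m p⊥m x^m≡1 y^m≡1 (mk≡mod x%M≡y%M)))
      onto
      where
        p⊥m = prime∤⇒coprime pp p∤m
        onto : ∀ {y} → y < M → Good M y → ∃ λ x → x < p * M × Good (p * M) x × x % M ≡ y
        onto {y} y<M (y^m≡1 , R-all) = from-lift (root-lift pp p∣M 0<m p⊥m y^m≡1)
          where
            from-lift : (∃ λ b → b ≡ y ⟨mod M ⟩ × b ^ m ≡ 1 ⟨mod p * M ⟩) →
              ∃ λ x → x < p * M × Good (p * M) x × x % M ≡ y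
            from-lift (b , b≡y , b^m≡1) = x , m%n<n b (p * M) , (x^m≡1 , R-all′) , ≡mod-<⇒%≡ y<M x≡y
              where
                x : ℕ
                x = b % (p * M)
                x≡y : x ≡ y ⟨mod M ⟩
                x≡y = ≡mod-trans (≡mod-∣ M∣pM (%-≡mod b)) b≡y
                x^m≡1 : x ^ m ≡ 1 ⟨mod p * M ⟩
                x^m≡1 = ≡mod-trans (^-cong-mod m (%-≡mod b)) b^m≡1
                R-all′ : ∀ p′ → Prime p′ → p′ ∣ p * M → R p′ x
                R-all′ p′ pp′ p′∣pM with prime∣p*M⇒≡∨∣ pp pp′ p′∣pM
                ... | inj₁ refl = R-resp-∣ pp′ p∣M (≡mod-sym x≡y) (R-all p pp p∣M)
                ... | inj₂ p′∣M = R-resp-∣ pp′ p′∣M (≡mod-sym x≡y) (R-all p′ pp′ p′∣M)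

    -- Chinese remainder theorem: b ↦ (b mod p, b mod M), encoded as in count-×.
    count-good-crt : ¬ p ∣ M → count (good? (p * M)) (p * M) ≡ count (localGood? pp) p * count (good? M) M
    count-good-crt p∤M = begin
      count (good? (p * M)) (p * M)
        ≡⟨ count-bijection (good? (p * M)) pair? (p * M) (M * p) h into (λ x< y< _ _ → h-injective x< y<) onto ⟩
      count pair? (M * p)             ≡⟨ count-× (localGood? pp) (good? M) p M ⟩
      count (good? M) M * count (localGood? pp) p ≡⟨ *-comm (count (good? M) M) _ ⟩
      count (localGood? pp) p * count (good? M) M ∎
      where
        open ≡-Reasoning
        pair? = λ z → localGood? pp (z % p) ×-dec good? M (z / p)
        h : ℕ → ℕ
        h b = b % p + b % M * p
        h%p : ∀ b → h b % p ≡ b % p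
        h%p b = m<n⇒[m+kn]%n≡m (b % M) (m%n<n b p)
        h/p : ∀ b → h b / p ≡ b % M
        h/p b = m<n⇒[m+kn]/n≡k (b % M) (m%n<n b p)
        h< : ∀ b → h b < M * p
        h< b = ≤-trans (+-monoˡ-< (b % M * p) (m%n<n b p)) (*-monoˡ-≤ p (m%n<n b M))
        h-injective : ∀ {x y} → x < p * M → y < p * M → h x ≡ h y → x ≡ y
        h-injective {x} {y} x< y< hx≡hy = ≡mod-<⇒≡ x< y< (≡mod-coprime (prime∤⇒coprime pp p∤M)
          (mk≡mod (trans (sym (h%p x)) (trans (cong (_% p) hx≡hy) (h%p y))))
          (mk≡mod (trans (sym (h/p x)) (trans (cong (_/ p) hx≡hy) (h/p y)))))
        p∣pM : p ∣ p * M
        p∣pM = m∣m*n M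
        into : ∀ {b} → b < p * M → Good (p * M) b →
          h b < M * p × ((h b % p) ^ m ≡ 1 ⟨mod p ⟩ × R p (h b % p)) × Good M (h b / p)
        into {b} _ good@(b^m≡1 , R-all) = h< b ,
          subst (λ z → z ^ m ≡ 1 ⟨mod p ⟩ × R p z) (sym (h%p b))
            (≡mod-trans (^-cong-mod m (%-≡mod b)) (≡mod-∣ p∣pM b^m≡1) , R-resp pp (≡mod-sym (%-≡mod b)) (R-all p pp p∣pM)) ,
          subst (Good M) (sym (h/p b)) (good-%M good)
        onto : ∀ {z} → z < M * p → ((z % p) ^ m ≡ 1 ⟨mod p ⟩ × R p (z % p)) × Good M (z / p) →
          ∃ λ x → x < p * M × Good (p * M) x × h x ≡ z
        onto {z} z< pair with injective⇒surjective (p * M) h (λ {x} _ → subst (h x <_) (*-comm M p) (h< x)) h-injective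
                                (subst (z <_) (*-comm M p) z<)
        ... | x , x< , refl = x , x< , (≡mod-coprime (prime∤⇒coprime pp p∤M) x^m≡1-mod-p x^m≡1-mod-M , R-all) , refl
          where
            local = subst (λ z → z ^ m ≡ 1 ⟨mod p ⟩ × R p z) (h%p x) (proj₁ pair)
            global = subst (Good M) (h/p x) (proj₂ pair)
            x^m≡1-mod-p : x ^ m ≡ 1 ⟨mod p ⟩
            x^m≡1-mod-p = ≡mod-trans (^-cong-mod m (≡mod-sym (%-≡mod x))) (proj₁ local)
            x^m≡1-mod-M : x ^ m ≡ 1 ⟨mod M ⟩
            x^m≡1-mod-M = ≡mod-trans (^-cong-mod m (≡mod-sym (%-≡mod x))) (proj₁ global)
            R-all : ∀ p′ → Prime p′ → p′ ∣ p * M → R p′ x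
            R-all p′ pp′ p′∣pM with prime∣p*M⇒≡∨∣ pp pp′ p′∣pM
            ... | inj₁ refl = R-resp pp (%-≡mod x) (proj₂ local)
            ... | inj₂ p′∣M = R-resp-∣ pp′ p′∣M (%-≡mod x) (proj₂ global p′ pp′ p′∣M)

  count-good-product : (c : ℕ → ℕ) (fs : List ℕ) (fsPrime : All Prime fs) →
    let instance _ = productOfPrimes≢0 fsPrime in
    (∀ p → Prime p → p ∣ product fs → ¬ p ∣ m) →
    (∀ {p} (pp : Prime p) → p ∣ product fs → c p ≡ count (localGood? {{prime⇒nonZero pp}} pp) p) →
    ∀ {ps} → PrimeDivisorList (product fs) ps → count (good? (product fs)) (product fs) ≡ product (map c ps)
  count-good-product c [] [] _ _ {[]} _ =
    count-all (good? 1) 1 (λ {x} _ → mk≡mod (trans (n%1≡0 (x ^ m)) (sym (n%1≡0 1))) , λ p pp p∣1 → ⊥-elim (prime∤1 pp p∣1))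
  count-good-product c [] [] _ _ {p ∷ _} (_ , ps⇔) =
    let pp , p∣1 = Equivalence.to (ps⇔ p) (here refl) in ⊥-elim (prime∤1 pp p∣1)
  count-good-product c (p ∷ fs) (pp ∷ fsPrime) coprime c-local {ps} ps-divisors = step (p ∣? M)
    where
      M = product fs
      instance _ = prime⇒nonZero pp ; _ = productOfPrimes≢0 fsPrime ; _ = productOfPrimes≢0 (pp ∷ fsPrime)
      ih : ∀ {ps′} → PrimeDivisorList M ps′ → count (good? M) M ≡ product (map c ps′)
      ih = count-good-product c fs fsPrime
        (λ p′ pp′ p′∣M → coprime p′ pp′ (∣-trans p′∣M (n∣m*n p)))
        (λ pp′ p′∣M → c-local pp′ (∣-trans p′∣M (n∣m*n p)))
      step : Dec (p ∣ M) → count (good? (p * M)) (p * M) ≡ product (map c ps)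
      step (yes p∣M) = trans (count-good-hensel pp p∣M (coprime p pp (m∣m*n M))) (ih (PrimeDivisorList-*-∣ pp p∣M ps-divisors))
      step (no p∤M)  = begin
        count (good? (p * M)) (p * M)                         ≡⟨ count-good-crt pp p∤M ⟩
        count (localGood? pp) p * count (good? M) M           ≡⟨ cong₂ _*_ (sym (c-local pp (m∣m*n M)))
                                                                  (ih (PrimeDivisorList-*-∤ pp p∤M ps-divisors)) ⟩
        c p * product (map c (filter (λ x → ¬? (x ≟ p)) ps))  ≡⟨ product-map-remove c ps (proj₁ ps-divisors)
                                                                  (Equivalence.from (proj₂ ps-divisors p) (pp , m∣m*n M)) ⟨
        product (map c ps)                                    ∎
        where open ≡-Reasoning

  count-good : (c : ℕ → ℕ) (M : ℕ) .{{_ : NonZero M}} → (∀ p → Prime p → p ∣ M → ¬ p ∣ m) →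
    (∀ {p} (pp : Prime p) → p ∣ M → c p ≡ count (localGood? {{prime⇒nonZero pp}} pp) p) →
    ∀ {ps} → PrimeDivisorList M ps → count (good? M) M ≡ product (map c ps)
  count-good c M with factorise M
  ... | record { factors = fs ; isFactorisation = refl ; factorsPrime = fsPrime } = count-good-product c fs fsPrime

-- Summing over the levels

∑≤ : ℕ → (ℕ → ℕ) → ℕ
∑≤ zero    f = f 0
∑≤ (suc K) f = ∑≤ K f + f (suc K)

∑≤-cong : ∀ K {f g : ℕ → ℕ} → (∀ k → k ≤ K → f k ≡ g k) → ∑≤ K f ≡ ∑≤ K g
∑≤-cong zero    f≡g = f≡g 0 z≤n
∑≤-cong (suc K) f≡g = cong₂ _+_ (∑≤-cong K (λ k k≤K → f≡g k (m≤n⇒m≤1+n k≤K))) (f≡g (suc K) ≤-refl)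

∑≤-*ʳ : ∀ K (f : ℕ → ℕ) c → ∑≤ K (λ k → f k * c) ≡ ∑≤ K f * c
∑≤-*ʳ zero    f c = refl
∑≤-*ʳ (suc K) f c = trans (cong (_+ f (suc K) * c) (∑≤-*ʳ K f c)) (sym (*-distribʳ-+ c (∑≤ K f) (f (suc K))))

φ[q^suc]^w : ∀ q j w → φ[ q ^ suc j ] ^ w ≡ (q ∸ 1) ^ w * q ^ (j * w)
φ[q^suc]^w q j w = trans (^-distribʳ-* (q ∸ 1) (q ^ j) w) (cong ((q ∸ 1) ^ w *_) (^-*-assoc q j w))

-- With Q = q ^ w - 1 and a = (q - 1) ^ w, the sum satisfies S Q + a = Q + a q ^ (ν w).
∑≤-φ[q^k]^w : ∀ q w ν .{{_ : NonZero q}} →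
  ∑≤ ν (λ k → φ[ q ^ k ] ^ w) * (q ^ w ∸ 1) ≡ (q ^ w ∸ 1) + (q ∸ 1) ^ w * (q ^ (ν * w) ∸ 1)
∑≤-φ[q^k]^w q w ν = +-cancelʳ-≡ a _ _ (begin
  S ν * Q + a                      ≡⟨ telescope ν ⟩
  Q + a * q ^ (ν * w)              ≡⟨ cong (λ z → Q + a * z) (m+[n∸m]≡n (m^n>0 q (ν * w))) ⟨
  Q + a * (1 + (q ^ (ν * w) ∸ 1))  ≡⟨ solve 3 (λ Q a y → Q :+ a :* (con 1 :+ y) := Q :+ a :* y :+ a) refl Q a (q ^ (ν * w) ∸ 1) ⟩
  Q + a * (q ^ (ν * w) ∸ 1) + a    ∎)
  where
    open ≡-Reasoning
    a = (q ∸ 1) ^ w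
    Q = q ^ w ∸ 1
    S = λ ν → ∑≤ ν (λ k → φ[ q ^ k ] ^ w)
    telescope : ∀ ν → S ν * Q + a ≡ Q + a * q ^ (ν * w)
    telescope zero = trans (cong (λ z → z * Q + a) (^-zeroˡ w)) (solve 2 (λ Q a → con 1 :* Q :+ a := Q :+ a :* con 1) refl Q a)
    telescope (suc j) = begin
      (S j + φ[ q ^ suc j ] ^ w) * Q + a      ≡⟨ cong (λ z → (S j + z) * Q + a) (φ[q^suc]^w q j w) ⟩
      (S j + a * y) * Q + a                   ≡⟨ solve 4 (λ Sj a y Q → (Sj :+ a :* y) :* Q :+ a := Sj :* Q :+ a :+ a :* y :* Q) refl (S j) a y Q ⟩
      S j * Q + a + a * y * Q                 ≡⟨ cong (_+ a * y * Q) (telescope j) ⟩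
      Q + a * y + a * y * Q                   ≡⟨ solve 3 (λ Q a y → Q :+ a :* y :+ a :* y :* Q := Q :+ a :* ((con 1 :+ Q) :* y)) refl Q a y ⟩
      Q + a * ((1 + Q) * y)                   ≡⟨ cong (λ z → Q + a * (z * y)) (m+[n∸m]≡n (m^n>0 q w)) ⟩
      Q + a * (q ^ w * y)                     ≡⟨ cong (λ z → Q + a * z) (^-distribˡ-+-* q w (j * w)) ⟨
      Q + a * q ^ (suc j * w)                 ∎
      where y = q ^ (j * w)

-- The q-probable prime bases of N

product-map-*ˡ : ∀ c (f : ℕ → ℕ) xs → product (map (λ x → c * f x) xs) ≡ c ^ length xs * product (map f xs)
product-map-*ˡ c f []       = refl
product-map-*ˡ c f (x ∷ xs) = begin
  c * f x * product (map (λ x → c * f x) xs)    ≡⟨ cong (c * f x *_) (product-map-*ˡ c f xs) ⟩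
  c * f x * (c ^ length xs * product (map f xs)) ≡⟨ *-interchange c (f x) (c ^ length xs) (product (map f xs)) ⟩
  c * c ^ length xs * (f x * product (map f xs)) ∎
  where open ≡-Reasoning

gcdList-∣ : ∀ {x} xs → x ∈ xs → gcdList xs ∣ x
gcdList-∣ (y ∷ ys) (here refl) = gcd[m,n]∣m y (gcdList ys)
gcdList-∣ (y ∷ ys) (there x∈) = ∣-trans (gcd[m,n]∣n y (gcdList ys)) (gcdList-∣ ys x∈)

gcdList-greatest : ∀ {d} xs → (∀ {x} → x ∈ xs → d ∣ x) → d ∣ gcdList xs
gcdList-greatest []       _   = _ ∣0
gcdList-greatest (x ∷ xs) d∣ = gcd-greatest (d∣ (here refl)) (gcdList-greatest xs (λ x∈ → d∣ (there x∈)))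

module QppBases {N q s t ν p₀ : ℕ} {ps : List ℕ} (odd : Odd N) (qp : Prime q)
  (p≡1 : ∀ p → Prime p → p ∣ N → p ≡ 1 [mod q ])
  (N-1≡q^s*t : N ∸ 1 ≡ q ^ s * t) (q⊥t : Coprime q t)
  (divisors : PrimeDivisorList N ps) (ν-val : Val q (gcdList (map (λ p → p ∸ 1) ps)) ν)
  (p₀∈ps : p₀ ∈ ps) where

  open LocalCount {s = s} qp q⊥t N-1≡q^s*t public

  instance
    N≢0 : NonZero N
    N≢0 = let k , N≡1+2k = odd in subst NonZero (sym N≡1+2k) _
    q≢0 : NonZero q
    q≢0 = prime⇒nonZero qp

  ∈ps⇒ : ∀ {p} → p ∈ ps → Prime p × p ∣ N
  ∈ps⇒ {p} = Equivalence.to (proj₂ divisors p)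

  ⇒∈ps : ∀ {p} → Prime p → p ∣ N → p ∈ ps
  ⇒∈ps {p} pp p∣N = Equivalence.from (proj₂ divisors p) (pp , p∣N)

  1≤N : 1 ≤ N
  1≤N = >-nonZero⁻¹ N

  p∤N-1 : ∀ p → Prime p → p ∣ N → ¬ p ∣ N ∸ 1
  p∤N-1 p pp p∣N p∣N-1 = prime∤1 pp (∣m+n∣m⇒∣n (subst (p ∣_) (sym (m∸n+n≡m 1≤N)) p∣N) p∣N-1)

  q^ν∣p-1 : ∀ {p} → p ∈ ps → q ^ ν ∣ p ∸ 1
  q^ν∣p-1 p∈ps = ∣-trans (proj₁ ν-val) (gcdList-∣ _ (∈-map⁺ (_∸ 1) p∈ps))

  ν≤s : ν ≤ s
  ν≤s with ν ≤? s
  ... | yes ν≤s = ν≤s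
  ... | no ν≰s = ⊥-elim (q^[j+1]∤q^j*t qp q⊥t s (∣-trans (^-∣-^ q (≰⇒> ν≰s)) q^ν∣q^st))
    where
      instance _ = m^n≢0 q ν
      -- every prime factor of N is ≡ 1 (mod q ^ ν), hence so is N
      N≡1 : N ≡ 1 ⟨mod q ^ ν ⟩
      N≡1 with factorise N
      ... | record { factors = fs ; isFactorisation = N≡∏fs ; factorsPrime = fsPrime } =
        ≡mod-trans (≡⇒≡mod N≡∏fs) (product-≡mod1 (All.tabulate λ f∈fs →
          prime-factor≡1 (All.lookup fsPrime f∈fs) (subst (_ ∣_) (sym N≡∏fs) (∈⇒∣product f∈fs))))
        where
          prime-factor≡1 : ∀ {p} → Prime p → p ∣ N → p ≡ 1 ⟨mod q ^ ν ⟩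
          prime-factor≡1 {p} pp p∣N =
            ∣∣-∣⇒≡mod (subst (q ^ ν ∣_) (sym (m≤n⇒∣n-m∣≡n∸m (<⇒≤ (prime>1 pp)))) (q^ν∣p-1 (⇒∈ps pp p∣N)))
      q^ν∣q^st : q ^ ν ∣ q ^ s * t
      q^ν∣q^st = subst (q ^ ν ∣_) (trans (m≤n⇒∣n-m∣≡n∸m 1≤N) N-1≡q^s*t) (≡mod⇒∣∣-∣ N≡1)

  module AtLevel (k : ℕ) = LocalGlobal (N ∸ 1) 0<m (Level k) (λ pp → level? pp k) (λ pp → orderSatisfies-resp-≡mod pp)

  atLevel? : ∀ k → Decidable (AtLevel.Good k N)
  atLevel? k = AtLevel.good? k N

  count-atLevel : ∀ k → k ≤ ν → count (atLevel? k) N ≡ φ[ q ^ k ] ^ length ps * product (map (λ p → gcd (p ∸ 1) t) ps)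
  count-atLevel k k≤ν = trans
    (AtLevel.count-good k (λ p → φ[ q ^ k ] * gcd (p ∸ 1) t) N p∤N-1
      (λ pp p∣N → sym (count-level {{prime⇒nonZero pp}} pp k (≤-trans k≤ν ν≤s)
                                    (∣-trans (^-∣-^ q k≤ν) (q^ν∣p-1 (⇒∈ps pp p∣N)))))
      divisors)
    (product-map-*ˡ φ[ q ^ k ] (λ p → gcd (p ∸ 1) t) ps)

  module _ {p : ℕ} (pp : Prime p) (p∣N : p ∣ N) where

    private instance _ = prime⇒nonZero pp

    order-mod-divisor : ∀ {b} → b ^ (N ∸ 1) ≡ 1 ⟨mod N ⟩ → ∃ λ o → Order b p o × o ∣ p ∸ 1
    order-mod-divisor b^m≡1 =
      let o , ord = order-exists pp _ (^-≡mod1⇒∤ pp 0<m (≡mod-∣ p∣N b^m≡1)) in o , ord , order-∣p-1 pp ord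

  private
    p₀-prime : Prime p₀
    p₀-prime = proj₁ (∈ps⇒ p₀∈ps)

    p₀∣N : p₀ ∣ N
    p₀∣N = proj₂ (∈ps⇒ p₀∈ps)

  atLevel-unique : ∀ {b k k′} → AtLevel.Good k N b → AtLevel.Good k′ N b → k ≡ k′
  atLevel-unique (b^m≡1 , levels) (_ , levels′) = let o , ord , _ = order-mod-divisor p₀-prime p₀∣N b^m≡1 in
    Val-unique (levels p₀ p₀-prime p₀∣N o ord) (levels′ p₀ p₀-prime p₀∣N o ord)

  atLevel⇒≤ν : ∀ {b k} → AtLevel.Good k N b → k ≤ ν
  atLevel⇒≤ν {b} {k} (b^m≡1 , levels) with k ≤? ν
  ... | yes k≤ν = k≤ν
  ... | no k≰ν = ⊥-elim (proj₂ ν-val (∣-trans (^-∣-^ q (≰⇒> k≰ν)) (gcdList-greatest _ q^k∣)))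
    where
      q^k∣ : ∀ {x} → x ∈ map (λ p → p ∸ 1) ps → q ^ k ∣ x
      q^k∣ x∈ with ∈-map⁻ (λ p → p ∸ 1) x∈
      ... | p , p∈ps , refl with ∈ps⇒ p∈ps
      ... | pp , p∣N = let o , ord , o∣p-1 = order-mod-divisor pp p∣N b^m≡1 in
        ∣-trans (proj₁ (levels p pp p∣N o ord)) o∣p-1

  AtLevel≤ : ℕ → ℕ → Set
  AtLevel≤ K b = ∃ λ k → k < suc K × AtLevel.Good k N b

  atLevel≤? : ∀ K → Decidable (AtLevel≤ K)
  atLevel≤? K b = anyUpTo? (λ k → atLevel? k b) (suc K)

  count-atLevel≤ : ∀ K → count (atLevel≤? K) N ≡ ∑≤ K (λ k → count (atLevel? k) N)
  count-atLevel≤ zero = count-cong (atLevel≤? 0) (atLevel? 0) N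
    (λ { _ (zero , _ , good) → good ; _ (suc _ , s≤s () , _) })
    (λ _ good → 0 , z<s , good)
  count-atLevel≤ (suc K) = begin
    count (atLevel≤? (suc K)) N                                ≡⟨ count-cong _ _ N (λ _ → split) (λ _ → merge) ⟩
    count (λ b → atLevel≤? K b ⊎-dec atLevel? (suc K) b) N     ≡⟨ count-⊎-disjoint (atLevel≤? K) (atLevel? (suc K)) N disjoint ⟩
    count (atLevel≤? K) N + count (atLevel? (suc K)) N         ≡⟨ cong (_+ count (atLevel? (suc K)) N) (count-atLevel≤ K) ⟩
    ∑≤ (suc K) (λ k → count (atLevel? k) N)                    ∎
    where
      open ≡-Reasoning
      split : ∀ {b} → AtLevel≤ (suc K) b → AtLevel≤ K b ⊎ AtLevel.Good (suc K) N b
      split (k , k<2+K , good) with m≤n⇒m<n∨m≡n (≤-pred k<2+K)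
      ... | inj₁ k<1+K = inj₁ (k , k<1+K , good)
      ... | inj₂ refl  = inj₂ good
      merge : ∀ {b} → AtLevel≤ K b ⊎ AtLevel.Good (suc K) N b → AtLevel≤ (suc K) b
      merge (inj₁ (k , k<1+K , good)) = k , m<n⇒m<1+n k<1+K , good
      merge (inj₂ good)               = suc K , ≤-refl , good
      disjoint : ∀ {b} → AtLevel≤ K b → AtLevel.Good (suc K) N b → ⊥
      disjoint (k , k<1+K , good) good′ = <⇒≢ k<1+K (atLevel-unique good good′)

  qpp⇒atLevel≤ν : ∀ {b} → InU N b × QProbablePrime q N b → b < N × AtLevel≤ ν b
  qpp⇒atLevel≤ν ((_ , b<N , _) , (_ , b^m≡1 , _ , _ , k , levels)) =
    b<N , k , s≤s (atLevel⇒≤ν good) , good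
    where good = [mod]⇒≡mod b^m≡1 , levels

  atLevel≤ν⇒qpp : ∀ {b} → b < N → AtLevel≤ ν b → InU N b × QProbablePrime q N b
  atLevel≤ν⇒qpp {b} b<N (k , _ , b^m≡1 , levels) =
    (0<b , b<N , b⊥N) , (b⊥N , ≡mod⇒[mod] b^m≡1 , qp , q∣p-1 , k , levels)
    where
      b⊥N = ^≡mod1⇒coprime 0<m b^m≡1
      0<b : 0 < b
      0<b = n≢0⇒n>0 λ { refl → <⇒≢ (≤-trans (prime>1 p₀-prime) (∣⇒≤ p₀∣N)) (sym (b⊥N (N ∣0 , ∣-refl))) }
      q∣p-1 : ∀ p → Prime p → p ∣ N → q ∣ p ∸ 1
      q∣p-1 p pp p∣N =
        subst (q ∣_) (m≤n⇒∣n-m∣≡n∸m (<⇒≤ (prime>1 pp))) (≡mod⇒∣∣-∣ ([mod]⇒≡mod {a = p} {b = 1} (p≡1 p pp p∣N)))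

  length-qppBases : ∀ {xs} → QppBaseList q N xs → length xs ≡ count (atLevel≤? ν) N
  length-qppBases {xs} (!xs , xs⇔) = unique-⊆⇒length-≡ xs (filter (atLevel≤? ν) (downFrom N)) !xs (unique-filter-downFrom _ N)
    (λ {b} b∈xs → let b<N , atLevel = qpp⇒atLevel≤ν (Equivalence.to (xs⇔ b) b∈xs)
                  in ∈-filter-downFrom⁺ (atLevel≤? ν) b<N atLevel)
    (λ {b} b∈ → let b<N , atLevel = ∈-filter-downFrom⁻ (atLevel≤? ν) b∈
                in Equivalence.from (xs⇔ b) (atLevel≤ν⇒qpp b<N atLevel))

mainTheorem4 : (N q : ℕ) → Odd N → Prime q →
    (∀ p → Prime p → p ∣ N → p ≡ 1 [mod q ]) →
    (s t : ℕ) → N ∸ 1 ≡ q ^ s * t → Coprime q t →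
    (ps : List ℕ) → PrimeDivisorList N ps →
    (ν : ℕ) → Val q (gcdList (map (λ p → p ∸ 1) ps)) ν →
    (xs : List ℕ) → QppBaseList q N xs →
    length xs * (q ^ length ps ∸ 1)
      ≡ ((q ^ length ps ∸ 1) + (q ∸ 1) ^ length ps * (q ^ (ν * length ps) ∸ 1))
        * product (map (λ p → gcd (p ∸ 1) t) ps)
-- With no prime divisors both sides vanish, as q ^ 0 ∸ 1 = 0.
mainTheorem4 N q _ _ _ s t _ _ [] _ ν _ xs _ rewrite *-zeroʳ ν | *-zeroʳ (length xs) = refl
mainTheorem4 N q odd qp p≡1 s t N-1≡q^s*t q⊥t ps@(_ ∷ _) divisors ν ν-val xs bases = begin
  length xs * Q                                  ≡⟨ cong (_* Q) (length-qppBases bases) ⟩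
  count (atLevel≤? ν) N * Q                      ≡⟨ cong (_* Q) (count-atLevel≤ ν) ⟩
  ∑≤ ν (λ k → count (atLevel? k) N) * Q          ≡⟨ cong (_* Q) (∑≤-cong ν count-atLevel) ⟩
  ∑≤ ν (λ k → φ[ q ^ k ] ^ w * G) * Q            ≡⟨ cong (_* Q) (∑≤-*ʳ ν (λ k → φ[ q ^ k ] ^ w) G) ⟩
  ∑≤ ν (λ k → φ[ q ^ k ] ^ w) * G * Q            ≡⟨ xy∙z≈xz∙y (∑≤ ν (λ k → φ[ q ^ k ] ^ w)) G Q ⟩
  ∑≤ ν (λ k → φ[ q ^ k ] ^ w) * Q * G            ≡⟨ cong (_* G) (∑≤-φ[q^k]^w q w ν) ⟩
  (Q + (q ∸ 1) ^ w * (q ^ (ν * w) ∸ 1)) * G      ∎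
  where
    open ≡-Reasoning
    open QppBases {s = s} {ν = ν} odd qp p≡1 N-1≡q^s*t q⊥t divisors ν-val (here refl)
    w = length ps
    Q = q ^ w ∸ 1
    G = product (map (λ p → gcd (p ∸ 1) t) ps)
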